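{- For all positive integers $w_1$ and $n=6w_1^2+2w_1$, \[A_4(n,2w-1,(w_1, w_1,w_1))=6w_1+2.\]
   Context: $A_4(n,d,\overline{w})$ is the maximum size of a quaternary code of length $n$ with minimum Hamming distance $d$ in which every codeword has exactly $w_i$ coordinates equal to $i$, $i=1,2,3$, where $\overline{w}=(w_1,w_2,w_3)$; $w=w_1+w_2+w_3$ (here $w=3w_1$). -}

module Defs where

open import Data.Nat using (ℕ; zero; suc; _+_; _*_; _∸_; _≤_)
open import Data.Fin using (Fin)
open import Data.Fin.Properties using (_≟_)
open import Data.Vec using (Vec; []; _∷_)
open import Data.List using (List; length)
open import Data.List.Relation.Unary.All using (All)
open import Data.List.Relation.Unary.AllPairs using (AllPairs)
open import Data.Product using (_×_; ∃-syntax; _,_)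
open import Relation.Nullary using (yes; no)
open import Relation.Binary.PropositionalEquality using (_≡_; _≢_)

Word : ℕ → Set
Word n = Vec (Fin 4) n

count : {n : ℕ} → Fin 4 → Word n → ℕ
count a [] = 0
count a (x ∷ xs) with x ≟ a
... | yes _ = suc (count a xs)
... | no  _ = count a xs

dist : {n : ℕ} → Word n → Word n → ℕ
dist [] [] = 0
dist (x ∷ xs) (y ∷ ys) with x ≟ y
... | yes _ = dist xs ys
... | no  _ = suc (dist xs ys)

HasComposition : {n : ℕ} → ℕ → ℕ → ℕ → Word n → Set
HasComposition w₁ w₂ w₃ x =
  (count (Fin.suc Fin.zero) x ≡ w₁) ×
  (count (Fin.suc (Fin.suc Fin.zero)) x ≡ w₂) ×
  (count (Fin.suc (Fin.suc (Fin.suc Fin.zero))) x ≡ w₃)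
  where import Data.Fin as Fin

-- A constant-composition code: a list of pairwise distinct codewords
-- (a finite set), each of composition (w₁,w₂,w₃), with pairwise
-- Hamming distance at least d.
IsCCCode : (n d w₁ w₂ w₃ : ℕ) → List (Word n) → Set
IsCCCode n d w₁ w₂ w₃ C =
  AllPairs _≢_ C ×
  All (HasComposition w₁ w₂ w₃) C ×
  AllPairs (λ x y → d ≤ dist x y) C

A₄≡ : (n d w₁ w₂ w₃ M : ℕ) → Set
A₄≡ n d w₁ w₂ w₃ M =
  (∃[ C ] (IsCCCode n d w₁ w₂ w₃ C × length C ≡ M)) ×
  (∀ (C : List (Word n)) → IsCCCode n d w₁ w₂ w₃ C → length C ≤ M)

module Submission where

-- For any two words, d(x, y) + 2·#{common 1s} ≤ wt x + wt y; words of
-- composition (w, w, w) have weight 3w, so at distance ≥ 6w - 1 they share no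
-- coordinate equal to 1.  Hence the 1s of the |C| codewords occupy disjoint sets of
-- w coordinates each, and |C|·w ≤ n = (6w + 2)·w.
--
-- Let m = 2w + 1.  On the 3m points Z_m × {0, 1, 2} take the blocks
--   cyc i z t = {(z + α_i t, i) ↦ 1, (z + β_i t, i) ↦ 2, (z, i + 1) ↦ 3}   (1 ≤ t ≤ w),
--   vert x    = {(x, 0) ↦ 1 or 2, (x, 1) ↦ 3, (x, 2) ↦ 2 or 1}   (by the parity of x),
-- where α_i + β_i = m and α_i, β_i, 2 are invertible modulo m.  Two points lie in at
-- most one block, and every point carries each symbol w times in cyclic blocks and
-- once more in its vertical block.  Delete the point ∞ = (0, 0) and the 3w + 1 blocks
-- through it: the incidence rows of the remaining 6w + 2 points have length
-- (m - 1)(3w + 1) = 6w² + 2w and composition (w, w, w) (the blocks through ∞ carry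
-- exactly the surplus symbols), and two rows meet in at most one column, with
-- different symbols there, so their distance is at least 6w - 1.

open import Defs
open import Agda.Primitive using (lzero)
open import Data.Nat using (ℕ; _+_; _*_; _∸_; _≤_)
open import Data.Nat using (zero; suc; z≤n; s≤s; _<_; _≤?_; NonZero; _%_; _/_)
open import Data.Nat.Properties
open import Data.Nat.DivMod using (m≡m%n+[m/n]*n; [m+kn]%n≡m%n; m<n⇒m%n≡m; m%n<n; m*n%n≡0; n%n≡0)
open import Data.Nat.Tactic.RingSolver using (solve-∀)
open import Data.Bool using (Bool; true; false)
open import Data.Empty using (⊥; ⊥-elim)
open import Data.Fin using (Fin) renaming (zero to fz; suc to fs)
import Data.Fin.Properties as FP
open import Data.Product using (Σ; ∃; _×_; _,_; proj₁; proj₂)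
open import Data.Sum using (_⊎_; inj₁; inj₂; [_,_]′)
open import Function using (_∘_)
open import Data.Vec using (Vec; []; _∷_; head; tail)
open import Data.List as L using (List; []; _∷_; length; map; _++_; applyUpTo)
open import Data.List.Properties using (length-map; length-++; length-applyUpTo)
open import Data.List.Relation.Unary.All as All using (All; []; _∷_)
import Data.List.Relation.Unary.All.Properties as All
open import Data.List.Relation.Unary.AllPairs as AP using (AllPairs; []; _∷_)
import Data.List.Relation.Unary.AllPairs.Properties as AllPairs
open import Relation.Nullary using (Dec; yes; no; ¬_; contradiction)
open import Relation.Nullary.Decidable using (True; toWitness)
open import Relation.Binary.Bundles using (Setoid)
open import Relation.Binary.PropositionalEquality
import Relation.Binary.Reasoning.Setoid as SetoidReasoning

χ : ∀ {p} {P : Set p} → Dec P → ℕ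
χ (yes _) = 1
χ (no _) = 0

χ-yes : ∀ {P : Set} (d : Dec P) → P → χ d ≡ 1
χ-yes (yes _) _ = refl
χ-yes (no ¬p) p = ⊥-elim (¬p p)

χ-no : ∀ {P : Set} (d : Dec P) → ¬ P → χ d ≡ 0
χ-no (yes p) ¬p = ⊥-elim (¬p p)
χ-no (no _) _ = refl

one two three : Fin 4
one = fs fz
two = fs (fs fz)
three = fs (fs (fs fz))

decide-≤ : ∀ {m n} {p : True (m ≤? n)} → m ≤ n
decide-≤ {p = p} = toWitness p

count-step : ∀ {n} a x (xs : Word n) → count a (x ∷ xs) ≡ χ (x FP.≟ a) + count a xs
count-step a x xs with x FP.≟ a
... | yes _ = refl
... | no _ = refl

dist-step : ∀ {n} x y (xs ys : Word n) → dist (x ∷ xs) (y ∷ ys) ≡ (1 ∸ χ (x FP.≟ y)) + dist xs ys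
dist-step x y xs ys with x FP.≟ y
... | yes _ = refl
... | no _ = refl

swap-middle : ∀ a b c d → (a + b) + (c + d) ≡ (a + c) + (b + d)
swap-middle = solve-∀

nonzero : Fin 4 → ℕ
nonzero fz = 0
nonzero (fs _) = 1

nonzero-counts : ∀ a → nonzero a ≡ χ (a FP.≟ one) + χ (a FP.≟ two) + χ (a FP.≟ three)
nonzero-counts fz = refl
nonzero-counts (fs fz) = refl
nonzero-counts (fs (fs fz)) = refl
nonzero-counts (fs (fs (fs fz))) = refl

weight : ∀ {n} → Word n → ℕ
weight [] = 0
weight (x ∷ xs) = nonzero x + weight xs

weight-counts : ∀ {n} (x : Word n) → weight x ≡ count one x + count two x + count three x
weight-counts [] = refl
weight-counts (a ∷ xs) = begin
  nonzero a + weight xs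
    ≡⟨ cong₂ _+_ (nonzero-counts a) (weight-counts xs) ⟩
  (χ (a FP.≟ one) + χ (a FP.≟ two) + χ (a FP.≟ three)) + (count one xs + count two xs + count three xs)
    ≡⟨ regroup (χ (a FP.≟ one)) (χ (a FP.≟ two)) (χ (a FP.≟ three)) (count one xs) (count two xs) (count three xs) ⟩
  (χ (a FP.≟ one) + count one xs) + (χ (a FP.≟ two) + count two xs) + (χ (a FP.≟ three) + count three xs)
    ≡⟨ sym (cong₂ _+_ (cong₂ _+_ (count-step one a xs) (count-step two a xs)) (count-step three a xs)) ⟩
  count one (a ∷ xs) + count two (a ∷ xs) + count three (a ∷ xs) ∎
  where
  open ≡-Reasoning
  regroup : ∀ a b c x y z → (a + b + c) + (x + y + z) ≡ (a + x) + (b + y) + (c + z)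
  regroup = solve-∀

weight-composition : ∀ {n w₁ w₂ w₃} (x : Word n) → HasComposition w₁ w₂ w₃ x → weight x ≡ w₁ + w₂ + w₃
weight-composition x (c₁ , c₂ , c₃) = trans (weight-counts x) (cong₂ _+_ (cong₂ _+_ c₁ c₂) c₃)

count-subst : ∀ a {i j} (e : i ≡ j) (v : Word i) → count a (subst Word e v) ≡ count a v
count-subst a refl v = refl

weight-subst : ∀ {i j} (e : i ≡ j) (v : Word i) → weight (subst Word e v) ≡ weight v
weight-subst refl v = refl

dist-subst : ∀ {i j} (e : i ≡ j) (v v' : Word i) → dist (subst Word e v) (subst Word e v') ≡ dist v v'
dist-subst refl v v' = refl

dist-self : ∀ {n} (x : Word n) → dist x x ≡ 0
dist-self [] = refl
dist-self (a ∷ xs) = trans (dist-step a a xs xs) (trans (cong (λ δ → (1 ∸ δ) + dist xs xs) (χ-yes (a FP.≟ a) refl)) (dist-self xs))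

far-words-distinct : ∀ {n d} {x y : Word n} → 1 ≤ d → d ≤ dist x y → x ≢ y
far-words-distinct {x = x} 1≤d d≤dist refl = contradiction (≤-trans 1≤d (subst (_ ≤_) (dist-self x) d≤dist)) (λ ())

allPairs-with : ∀ {A : Set} {P : A → Set} {R S : A → A → Set} → (∀ {x y} → P x → P y → R x y → S x y) →
                ∀ {xs} → All P xs → AllPairs R xs → AllPairs S xs
allPairs-with f [] [] = []
allPairs-with f (px ∷ pxs) (rx ∷ rxs) = All.zipWith (λ { (py , r) → f px py r }) (pxs , rx) ∷ allPairs-with f pxs rxs

common-ones : ∀ {n} → Word n → Word n → ℕ
common-ones [] [] = 0
common-ones (x ∷ xs) (y ∷ ys) = χ (x FP.≟ one) * χ (y FP.≟ one) + common-ones xs ys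

coordinate-upper-bound : ∀ a b → (1 ∸ χ (a FP.≟ b)) + 2 * (χ (a FP.≟ one) * χ (b FP.≟ one)) ≤ nonzero a + nonzero b
coordinate-upper-bound fz fz = decide-≤
coordinate-upper-bound fz (fs fz) = decide-≤
coordinate-upper-bound fz (fs (fs fz)) = decide-≤
coordinate-upper-bound fz (fs (fs (fs fz))) = decide-≤
coordinate-upper-bound (fs fz) fz = decide-≤
coordinate-upper-bound (fs fz) (fs fz) = decide-≤
coordinate-upper-bound (fs fz) (fs (fs fz)) = decide-≤
coordinate-upper-bound (fs fz) (fs (fs (fs fz))) = decide-≤
coordinate-upper-bound (fs (fs fz)) fz = decide-≤
coordinate-upper-bound (fs (fs fz)) (fs fz) = decide-≤
coordinate-upper-bound (fs (fs fz)) (fs (fs fz)) = decide-≤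
coordinate-upper-bound (fs (fs fz)) (fs (fs (fs fz))) = decide-≤
coordinate-upper-bound (fs (fs (fs fz))) fz = decide-≤
coordinate-upper-bound (fs (fs (fs fz))) (fs fz) = decide-≤
coordinate-upper-bound (fs (fs (fs fz))) (fs (fs fz)) = decide-≤
coordinate-upper-bound (fs (fs (fs fz))) (fs (fs (fs fz))) = decide-≤

distance-common-ones-bound : ∀ {n} (x y : Word n) → dist x y + 2 * common-ones x y ≤ weight x + weight y
distance-common-ones-bound [] [] = z≤n
distance-common-ones-bound (a ∷ xs) (b ∷ ys) rewrite dist-step a b xs ys =
  subst₂ _≤_ (regroup (1 ∸ χ (a FP.≟ b)) (dist xs ys) (χ (a FP.≟ one) * χ (b FP.≟ one)) (common-ones xs ys))
             (swap-middle (nonzero a) (nonzero b) (weight xs) (weight ys))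
    (+-mono-≤ (coordinate-upper-bound a b) (distance-common-ones-bound xs ys))
  where
  regroup : ∀ δ D o O → (δ + 2 * o) + (D + 2 * O) ≡ (δ + D) + 2 * (o + O)
  regroup = solve-∀

no-room-for-common-ones : ∀ D o M → M ∸ 1 ≤ D → D + 2 * o ≤ M → o ≡ 0
no-room-for-common-ones D zero M _ _ = refl
no-room-for-common-ones D (suc o) M D≥M-1 bound = ⊥-elim (<-irrefl refl (≤-trans D<M-1 D≥M-1))
  where
  2+D≤M : 2 + D ≤ M
  2+D≤M = ≤-trans (≤-reflexive (+-comm 2 D)) (≤-trans (+-monoʳ-≤ D (*-monoʳ-≤ 2 (s≤s z≤n))) bound)
  D<M-1 : suc D ≤ M ∸ 1
  D<M-1 = ∸-monoˡ-≤ 1 2+D≤M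

OnesDisjoint : ∀ {n} → Word n → Word n → Set
OnesDisjoint x y = common-ones x y ≡ 0

ones-total : ∀ {n} → List (Word n) → ℕ
ones-total [] = 0
ones-total (x ∷ C) = count one x + ones-total C

ones-in-head : ∀ {n} → List (Word (suc n)) → ℕ
ones-in-head [] = 0
ones-in-head (x ∷ C) = χ (head x FP.≟ one) + ones-in-head C

ones-total-split : ∀ {n} (C : List (Word (suc n))) → ones-total C ≡ ones-in-head C + ones-total (map tail C)
ones-total-split [] = refl
ones-total-split ((a ∷ xs) ∷ C) rewrite count-step one a xs | ones-total-split C =
  swap-middle (χ (a FP.≟ one)) (count one xs) (ones-in-head C) (ones-total (map tail C))

disjoint-heads : ∀ {n} (C : List (Word (suc n))) → AllPairs OnesDisjoint C → ones-in-head C ≤ 1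
disjoint-heads [] [] = z≤n
disjoint-heads ((a ∷ xs) ∷ C) (disj ∷ disjs) with a FP.≟ one
... | no _ = disjoint-heads C disjs
... | yes a≡1 = ≤-reflexive (cong suc (no-other-head C (All.map (λ {y} → head-not-one y) disj)))
  where
  head-not-one : ∀ y → OnesDisjoint (a ∷ xs) y → χ (head y FP.≟ one) ≡ 0
  head-not-one (b ∷ ys) no-common rewrite a≡1 = trans (sym (+-identityʳ _)) (m+n≡0⇒m≡0 _ no-common)
  no-other-head : ∀ C → All (λ y → χ (head y FP.≟ one) ≡ 0) C → ones-in-head C ≡ 0
  no-other-head [] [] = refl
  no-other-head (y ∷ C) (e ∷ es) rewrite e = no-other-head C es

disjoint-ones-bound : ∀ n (C : List (Word n)) → AllPairs OnesDisjoint C → ones-total C ≤ n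
disjoint-ones-bound zero C _ = ≤-reflexive (no-ones C)
  where
  no-ones : (C : List (Word 0)) → ones-total C ≡ 0
  no-ones [] = refl
  no-ones ([] ∷ C) = no-ones C
disjoint-ones-bound (suc n) C disj = subst (_≤ suc n) (sym (ones-total-split C))
  (+-mono-≤ (disjoint-heads C disj) (disjoint-ones-bound n (map tail C) (AllPairs.map⁺ (AP.map (λ {x} {y} → tails x y) disj))))
  where
  tails : (x y : Word (suc n)) → OnesDisjoint x y → OnesDisjoint (tail x) (tail y)
  tails (a ∷ xs) (b ∷ ys) no-common = m+n≡0⇒n≡0 (χ (a FP.≟ one) * χ (b FP.≟ one)) no-common

code-size-bound : ∀ n w (C : List (Word n)) → IsCCCode n (2 * (3 * w) ∸ 1) w w w C → length C * w ≤ n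
code-size-bound n w C (_ , compositions , distances) =
  subst (_≤ n) (ones-total-composition C compositions)
    (disjoint-ones-bound n C (allPairs-with (λ {x} {y} → far-words-disjoint x y) compositions distances))
  where
  six-w : ∀ w → 2 * (3 * w) ≡ (w + w + w) + (w + w + w)
  six-w = solve-∀
  far-words-disjoint : ∀ x y → HasComposition w w w x → HasComposition w w w y →
                       2 * (3 * w) ∸ 1 ≤ dist x y → OnesDisjoint x y
  far-words-disjoint x y cx cy far = no-room-for-common-ones (dist x y) (common-ones x y) (2 * (3 * w)) far
    (subst (dist x y + 2 * common-ones x y ≤_)
      (trans (cong₂ _+_ (weight-composition x cx) (weight-composition y cy)) (sym (six-w w)))
      (distance-common-ones-bound x y))
  ones-total-composition : ∀ C → All (HasComposition w w w) C → ones-total C ≡ length C * w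
  ones-total-composition [] [] = refl
  ones-total-composition (x ∷ C) (cx ∷ cC) = cong₂ _+_ (proj₁ cx) (ones-total-composition C cC)

code-size-at-most-6w+2 : ∀ w .{{_ : NonZero w}} (C : List (Word (6 * w * w + 2 * w))) →
  IsCCCode (6 * w * w + 2 * w) (2 * (3 * w) ∸ 1) w w w C → length C ≤ 6 * w + 2
code-size-at-most-6w+2 w C isCode =
  *-cancelʳ-≤ (length C) (6 * w + 2) w (subst (length C * w ≤_) (factor w) (code-size-bound _ w C isCode))
  where
  factor : ∀ w → 6 * w * w + 2 * w ≡ (6 * w + 2) * w
  factor = solve-∀

sumBelow : ℕ → (ℕ → ℕ) → ℕ
sumBelow zero f = 0
sumBelow (suc N) f = f 0 + sumBelow N (λ i → f (suc i))

sumBelow-cong : ∀ N f g → (∀ i → i < N → f i ≡ g i) → sumBelow N f ≡ sumBelow N g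
sumBelow-cong zero f g f≡g = refl
sumBelow-cong (suc N) f g f≡g =
  cong₂ _+_ (f≡g 0 (s≤s z≤n)) (sumBelow-cong N _ _ (λ i i<N → f≡g (suc i) (s≤s i<N)))

sumBelow-+ : ∀ N f g → sumBelow N (λ i → f i + g i) ≡ sumBelow N f + sumBelow N g
sumBelow-+ zero f g = refl
sumBelow-+ (suc N) f g rewrite sumBelow-+ N (λ i → f (suc i)) (λ i → g (suc i)) = swap-middle (f 0) (g 0) _ _

sumBelow-*ˡ : ∀ N c f → sumBelow N (λ i → c * f i) ≡ c * sumBelow N f
sumBelow-*ˡ zero c f = sym (*-zeroʳ c)
sumBelow-*ˡ (suc N) c f =
  trans (cong (c * f 0 +_) (sumBelow-*ˡ N c (λ i → f (suc i)))) (sym (*-distribˡ-+ c (f 0) _))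

sumBelow-const : ∀ N c → sumBelow N (λ _ → c) ≡ N * c
sumBelow-const zero c = refl
sumBelow-const (suc N) c = cong (c +_) (sumBelow-const N c)

sumBelow-zero : ∀ N f → (∀ i → i < N → f i ≡ 0) → sumBelow N f ≡ 0
sumBelow-zero N f f≡0 = trans (sumBelow-cong N f (λ _ → 0) f≡0) (trans (sumBelow-const N 0) (*-zeroʳ N))

sumBelow-single : ∀ N f i₀ → i₀ < N → (∀ i → i < N → i ≢ i₀ → f i ≡ 0) → sumBelow N f ≡ f i₀
sumBelow-single (suc N) f zero _ others =
  trans (cong (f 0 +_) (sumBelow-zero N _ (λ i i<N → others (suc i) (s≤s i<N) (λ ())))) (+-identityʳ _)
sumBelow-single (suc N) f (suc i₀) (s≤s i₀<N) others =
  cong₂ _+_ (others 0 (s≤s z≤n) (λ ()))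
            (sumBelow-single N (λ i → f (suc i)) i₀ i₀<N (λ i i<N i≢i₀ → others (suc i) (s≤s i<N) (i≢i₀ ∘ suc-injective)))

sumBelow-χ-unique : ∀ N {P : ℕ → Set} (P? : ∀ i → Dec (P i)) i₀ → i₀ < N → P i₀ →
                    (∀ i → i < N → P i → i ≡ i₀) → sumBelow N (λ i → χ (P? i)) ≡ 1
sumBelow-χ-unique N P? i₀ i₀<N Pi₀ unique =
  trans (sumBelow-single N _ i₀ i₀<N (λ i i<N i≢i₀ → χ-no (P? i) (λ Pi → i≢i₀ (unique i i<N Pi)))) (χ-yes (P? i₀) Pi₀)

sumBelow-χ-none : ∀ N {P : ℕ → Set} (P? : ∀ i → Dec (P i)) → (∀ i → i < N → ¬ P i) → sumBelow N (λ i → χ (P? i)) ≡ 0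
sumBelow-χ-none N P? none = sumBelow-zero N _ (λ i i<N → χ-no (P? i) (none i i<N))

sumBelow-pick : ∀ N a (h : ℕ → ℕ) → a < N → sumBelow N (λ i → χ (i ≟ a) * h i) ≡ h a
sumBelow-pick N a h a<N = trans (sumBelow-single N _ a a<N (λ i _ i≢a → cong (_* h i) (χ-no (i ≟ a) i≢a)))
  (trans (cong (_* h a) (χ-yes (a ≟ a) refl)) (+-identityʳ (h a)))

sumBelow-positive : ∀ N f → 1 ≤ sumBelow N f → ∃ λ i → i < N × 1 ≤ f i
sumBelow-positive zero f ()
sumBelow-positive (suc N) f pos with f 0 ≟ 0
... | no f0≢0 = 0 , s≤s z≤n , n≢0⇒n>0 f0≢0
... | yes f0≡0 with sumBelow-positive N (λ i → f (suc i)) (subst (λ v → 1 ≤ v + sumBelow N (λ i → f (suc i))) f0≡0 pos)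
...   | i , i<N , fi = suc i , s≤s i<N , fi

sumBelow-≤1 : ∀ N f → (∀ i → i < N → f i ≤ 1) → (∀ i j → i < N → j < N → 1 ≤ f i → 1 ≤ f j → i ≡ j) →
              sumBelow N f ≤ 1
sumBelow-≤1 zero f _ _ = z≤n
sumBelow-≤1 (suc N) f bounded unique with f 0 ≟ 0
... | yes f0≡0 = subst (λ v → v + rest ≤ 1) (sym f0≡0)
      (sumBelow-≤1 N (λ i → f (suc i)) (λ i i<N → bounded (suc i) (s≤s i<N))
        (λ i j i<N j<N fi fj → suc-injective (unique (suc i) (suc j) (s≤s i<N) (s≤s j<N) fi fj)))
  where rest = sumBelow N (λ i → f (suc i))
... | no f0≢0 = subst (λ v → f 0 + v ≤ 1) (sym rest≡0) (subst (_≤ 1) (sym (+-identityʳ (f 0))) (bounded 0 (s≤s z≤n)))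
  where
  others-vanish : ∀ i → i < N → f (suc i) ≡ 0
  others-vanish i i<N with f (suc i) ≟ 0
  ... | yes fi≡0 = fi≡0
  ... | no fi≢0 = contradiction (unique (suc i) 0 (s≤s i<N) (s≤s z≤n) (n≢0⇒n>0 fi≢0) (n≢0⇒n>0 f0≢0)) (λ ())
  rest≡0 : sumBelow N (λ i → f (suc i)) ≡ 0
  rest≡0 = sumBelow-zero N _ others-vanish

-- Congruence modulo m, written x + a·m = y + b·m so that additive cancellation is immediate.
module Congruence (m : ℕ) .{{_ : NonZero m}} where
  infix 4 _≈_
  _≈_ : ℕ → ℕ → Set
  x ≈ y = Σ ℕ λ a → Σ ℕ λ b → x + a * m ≡ y + b * m

  ≈-refl : ∀ {x} → x ≈ x
  ≈-refl = 0 , 0 , refl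

  ≈-reflexive : ∀ {x y} → x ≡ y → x ≈ y
  ≈-reflexive refl = ≈-refl

  ≈-sym : ∀ {x y} → x ≈ y → y ≈ x
  ≈-sym (a , b , e) = b , a , sym e

  ≈-trans : ∀ {x y z} → x ≈ y → y ≈ z → x ≈ z
  ≈-trans {x} {y} {z} (a , b , e) (c , d , f) = a + c , d + b , (begin
    x + (a + c) * m       ≡⟨ shuffle₁ x a c m ⟩
    (x + a * m) + c * m   ≡⟨ cong (_+ c * m) e ⟩
    (y + b * m) + c * m   ≡⟨ shuffle₂ y b c m ⟩
    (y + c * m) + b * m   ≡⟨ cong (_+ b * m) f ⟩
    (z + d * m) + b * m   ≡⟨ shuffle₃ z d b m ⟩
    z + (d + b) * m       ∎)
    where
    open ≡-Reasoning
    shuffle₁ : ∀ x a c m → x + (a + c) * m ≡ (x + a * m) + c * m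
    shuffle₁ = solve-∀
    shuffle₂ : ∀ y b c m → (y + b * m) + c * m ≡ (y + c * m) + b * m
    shuffle₂ = solve-∀
    shuffle₃ : ∀ z d b m → (z + d * m) + b * m ≡ z + (d + b) * m
    shuffle₃ = solve-∀

  ≈-setoid : Setoid lzero lzero
  ≈-setoid = record
    { Carrier = ℕ ; _≈_ = _≈_ ; isEquivalence = record { refl = ≈-refl ; sym = ≈-sym ; trans = ≈-trans } }

  module ≈-Reasoning = SetoidReasoning ≈-setoid

  ≈-+ : ∀ {x y x' y'} → x ≈ y → x' ≈ y' → x + x' ≈ y + y'
  ≈-+ {x} {y} {x'} {y'} (a , b , e) (c , d , f) = a + c , b + d ,
    trans (shuffle x x' a c m) (trans (cong₂ _+_ e f) (sym (shuffle y y' b d m)))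
    where
    shuffle : ∀ x x' a c m → x + x' + (a + c) * m ≡ (x + a * m) + (x' + c * m)
    shuffle = solve-∀

  ≈-*ˡ : ∀ c {x y} → x ≈ y → c * x ≈ c * y
  ≈-*ˡ c {x} {y} (a , b , e) = c * a , c * b ,
    trans (distrib c x a m) (trans (cong (c *_) e) (sym (distrib c y b m)))
    where
    distrib : ∀ c x a m → c * x + c * a * m ≡ c * (x + a * m)
    distrib = solve-∀

  ≈-cancelˡ : ∀ c {x y} → c + x ≈ c + y → x ≈ y
  ≈-cancelˡ c {x} {y} (a , b , e) = a , b , +-cancelˡ-≡ c _ _ (trans (sym (+-assoc c x _)) (trans e (+-assoc c y _)))

  ≈-cancelʳ : ∀ c {x y} → x + c ≈ y + c → x ≈ y
  ≈-cancelʳ c {x} {y} h = ≈-cancelˡ c (≈-trans (≈-reflexive (+-comm c x)) (≈-trans h (≈-reflexive (+-comm y c))))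

  %-≈ : ∀ x → x % m ≈ x
  %-≈ x = x / m , 0 , trans (sym (m≡m%n+[m/n]*n x m)) (sym (+-identityʳ x))

  %-≡⇒≈ : ∀ {a b} → a % m ≡ b % m → a ≈ b
  %-≡⇒≈ {a} {b} e = ≈-trans (≈-sym (%-≈ a)) (≈-trans (≈-reflexive e) (%-≈ b))

  m*≈0 : ∀ t → m * t ≈ 0
  m*≈0 t = 0 , t , trans (+-identityʳ _) (*-comm m t)

  m≈0 : m ≈ 0
  m≈0 = ≈-trans (≈-reflexive (sym (*-identityʳ m))) (m*≈0 1)

  ≈-residue : ∀ {x y} → x < m → y < m → x ≈ y → x ≡ y
  ≈-residue {x} {y} x<m y<m (a , b , e) = begin
    x                 ≡⟨ sym (m<n⇒m%n≡m x<m) ⟩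
    x % m             ≡⟨ sym ([m+kn]%n≡m%n x a m) ⟩
    (x + a * m) % m   ≡⟨ cong (_% m) e ⟩
    (y + b * m) % m   ≡⟨ [m+kn]%n≡m%n y b m ⟩
    y % m             ≡⟨ m<n⇒m%n≡m y<m ⟩
    y                 ∎
    where open ≡-Reasoning

  nonzero-residue : ∀ {t} → 1 ≤ t → t < m → t ≈ 0 → ⊥
  nonzero-residue {suc t} _ t<m h with ≈-residue t<m (≤-trans (s≤s z≤n) t<m) h
  ... | ()

  Invertible : ℕ → Set
  Invertible u = Σ ℕ λ e → Σ ℕ λ K → e * u ≡ 1 + K * m

  invertible-cancel : ∀ {u x y} → Invertible u → u * x ≈ u * y → x ≈ y
  invertible-cancel {u} {x} {y} (e , K , eu≡1) ux≈uy with ≈-*ˡ e ux≈uy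
  ... | (a , b , q) = K * x + a , K * y + b , (begin
    x + (K * x + a) * m       ≡⟨ expand x K a m ⟩
    (1 + K * m) * x + a * m   ≡⟨ cong (λ v → v * x + a * m) (sym eu≡1) ⟩
    e * u * x + a * m         ≡⟨ cong (_+ a * m) (*-assoc e u x) ⟩
    e * (u * x) + a * m       ≡⟨ q ⟩
    e * (u * y) + b * m       ≡⟨ cong (_+ b * m) (sym (*-assoc e u y)) ⟩
    e * u * y + b * m         ≡⟨ cong (λ v → v * y + b * m) eu≡1 ⟩
    (1 + K * m) * y + b * m   ≡⟨ sym (expand y K b m) ⟩
    y + (K * y + b) * m       ∎)
    where
    open ≡-Reasoning
    expand : ∀ x K a m → x + (K * x + a) * m ≡ (1 + K * m) * x + a * m
    expand = solve-∀

  shift-injective : ∀ {γ} → Invertible γ → ∀ z t t' → t < m → t' < m → z + γ * t ≈ z + γ * t' → t ≡ t'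
  shift-injective inv-mult z t t' t<m t'<m h = ≈-residue t<m t'<m (invertible-cancel inv-mult (≈-cancelˡ z h))

  shift-moves : ∀ {γ} → Invertible γ → ∀ z t → 1 ≤ t → t < m → z + γ * t ≈ z → ⊥
  shift-moves {γ} inv-mult z t 1≤t t<m h = nonzero-residue 1≤t t<m
    (invertible-cancel inv-mult (≈-cancelˡ z (≈-trans h (≈-reflexive (sym (trans (cong (z +_) (*-zeroʳ γ)) (+-identityʳ z)))))))

  -- The three points z + α·t, z + β·t (and z) recover z and t, which is what makes
  -- the developed base blocks of the construction pairwise edge-disjoint.
  module OppositeMultipliers (α β : ℕ) (α+β≡m : α + β ≡ m)
                             (invα : Invertible α) (inv2 : Invertible 2) where

    opposite-shifts-sum : ∀ z t → (z + α * t) + (z + β * t) ≈ 2 * z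
    opposite-shifts-sum z t =
      ≈-trans (≈-reflexive (trans (collect α β z t) (cong (λ v → 2 * z + v * t) α+β≡m)))
              (≈-trans (≈-+ (≈-refl {2 * z}) (m*≈0 t)) (≈-reflexive (+-identityʳ _)))
      where
      collect : ∀ α β z t → (z + α * t) + (z + β * t) ≡ 2 * z + (α + β) * t
      collect = solve-∀

    opposite-shifts-differ : ∀ z t t' → 1 ≤ t → t + t' < m → z + α * t ≈ z + β * t' → ⊥
    opposite-shifts-differ z t t' 1≤t t+t'<m h =
      nonzero-residue (≤-trans 1≤t (m≤m+n t t')) t+t'<m (invertible-cancel invα α[t+t']≈0)
      where
      αt≈βt' : α * t ≈ β * t'
      αt≈βt' = ≈-cancelˡ z h
      αt+αt'≈0 : α * t + α * t' ≈ 0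
      αt+αt'≈0 = ≈-trans (≈-+ αt≈βt' (≈-refl {α * t'}))
        (≈-trans (≈-reflexive (trans (sym (*-distribʳ-+ t' β α)) (cong (_* t') (trans (+-comm β α) α+β≡m)))) (m*≈0 t'))
      α[t+t']≈0 : α * (t + t') ≈ α * 0
      α[t+t']≈0 = ≈-trans (≈-reflexive (*-distribˡ-+ α t t')) (≈-trans αt+αt'≈0 (≈-reflexive (sym (*-zeroʳ α))))

    opposite-shifts-differ' : ∀ z t t' → 1 ≤ t' → t + t' < m → z + β * t ≈ z + α * t' → ⊥
    opposite-shifts-differ' z t t' 1≤t' t+t'<m h =
      opposite-shifts-differ z t' t 1≤t' (subst (_< m) (+-comm t t') t+t'<m) (≈-sym h)

    shift-pair-determines : ∀ z z' t t' → z < m → z' < m → t < m → t' < m →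
      z + α * t ≈ z' + α * t' → z + β * t ≈ z' + β * t' → z ≡ z' × t ≡ t'
    shift-pair-determines z z' t t' z<m z'<m t<m t'<m hα hβ =
      z≡z' , shift-injective invα z t t' t<m t'<m (≈-trans hα (≈-reflexive (cong (λ v → v + α * t') (sym z≡z'))))
      where
      z≡z' : z ≡ z'
      z≡z' = ≈-residue z<m z'<m (invertible-cancel inv2
        (≈-trans (≈-sym (opposite-shifts-sum z t)) (≈-trans (≈-+ hα hβ) (opposite-shifts-sum z' t'))))

    shift-pair-uncrossed : ∀ z z' t t' → z < m → z' < m → 1 ≤ t → t + t' < m →
      z + α * t ≈ z' + β * t' → z + β * t ≈ z' + α * t' → ⊥
    shift-pair-uncrossed z z' t t' z<m z'<m 1≤t t+t'<m hα hβ =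
      opposite-shifts-differ z t t' 1≤t t+t'<m (≈-trans hα (≈-reflexive (cong (λ v → v + β * t') (sym z≡z'))))
      where
      z≡z' : z ≡ z'
      z≡z' = ≈-residue z<m z'<m (invertible-cancel inv2 (≈-trans (≈-sym (opposite-shifts-sum z t))
               (≈-trans (≈-+ hα hβ) (≈-trans (≈-reflexive (+-comm (z' + β * t') _)) (opposite-shifts-sum z' t')))))

data Level : Set where
  l0 l1 l2 : Level

_≟ℓ_ : (i j : Level) → Dec (i ≡ j)
l0 ≟ℓ l0 = yes refl
l0 ≟ℓ l1 = no (λ ())
l0 ≟ℓ l2 = no (λ ())
l1 ≟ℓ l0 = no (λ ())
l1 ≟ℓ l1 = yes refl
l1 ≟ℓ l2 = no (λ ())
l2 ≟ℓ l0 = no (λ ())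
l2 ≟ℓ l1 = no (λ ())
l2 ≟ℓ l2 = yes refl

next : Level → Level
next l0 = l1
next l1 = l2
next l2 = l0

next-≢ : ∀ i → i ≢ next i
next-≢ l0 ()
next-≢ l1 ()
next-≢ l2 ()

next²-≢ : ∀ i → i ≢ next (next i)
next²-≢ l0 ()
next²-≢ l1 ()
next²-≢ l2 ()

l0≢l1 : l0 ≢ l1
l0≢l1 ()

l0≢l2 : l0 ≢ l2
l0≢l2 ()

-- A point (u , i) of the design: a residue u (below m) on level i.
Point : Set
Point = ℕ × Level

_≟ₚ_ : (p q : Point) → Dec (p ≡ q)
_≟ₚ_ = ×-≡-dec _≟_ _≟ℓ_
  where open import Data.Product.Properties using () renaming (≡-dec to ×-≡-dec)

-- Each column of the code is a block of three points; the slot of a point in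
-- its block decides the symbol written there.
data Slot : Set where
  slot₁ slot₂ slot₃ : Slot

_≟ₛ_ : (i j : Slot) → Dec (i ≡ j)
slot₁ ≟ₛ slot₁ = yes refl
slot₁ ≟ₛ slot₂ = no (λ ())
slot₁ ≟ₛ slot₃ = no (λ ())
slot₂ ≟ₛ slot₁ = no (λ ())
slot₂ ≟ₛ slot₂ = yes refl
slot₂ ≟ₛ slot₃ = no (λ ())
slot₃ ≟ₛ slot₁ = no (λ ())
slot₃ ≟ₛ slot₂ = no (λ ())
slot₃ ≟ₛ slot₃ = yes refl

even? : ℕ → Bool
even? zero = true
even? (suc zero) = false
even? (suc (suc n)) = even? n

bit : Bool → ℕ
bit true = 1
bit false = 0

even?-double : ∀ h → even? (h + h) ≡ true
even?-double zero = refl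
even?-double (suc h) rewrite +-suc h h = even?-double h

even?-odd : ∀ h → even? (suc (h + h)) ≡ false
even?-odd zero = refl
even?-odd (suc h) rewrite +-suc h h = even?-odd h

double-or-odd : ∀ u → (Σ ℕ λ h → u ≡ h + h) ⊎ (Σ ℕ λ h → u ≡ suc (h + h))
double-or-odd zero = inj₁ (0 , refl)
double-or-odd (suc zero) = inj₂ (0 , refl)
double-or-odd (suc (suc u)) with double-or-odd u
... | inj₁ (h , e) = inj₁ (suc h , trans (cong (λ v → suc (suc v)) e) (cong suc (sym (+-suc h h))))
... | inj₂ (h , e) = inj₂ (suc h , trans (cong (λ v → suc (suc v)) e) (cong (λ v → suc (suc v)) (sym (+-suc h h))))

double-injective : ∀ {h h'} → h + h ≡ h' + h' → h ≡ h'
double-injective {zero} {zero} e = refl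
double-injective {suc h} {suc h'} e =
  cong suc (double-injective (suc-injective (trans (sym (+-suc h h)) (trans (suc-injective e) (+-suc h' h')))))

double≢odd : ∀ h h' → h + h ≢ suc (h' + h')
double≢odd h h' e with trans (sym (even?-double h)) (trans (cong even? e) (even?-odd h'))
... | ()

σ₀ᵇ σ₂ᵇ : Bool → Fin 4
σ₀ᵇ true = one
σ₀ᵇ false = two
σ₂ᵇ true = two
σ₂ᵇ false = one

σ₀ᵇ≢3 : ∀ b → σ₀ᵇ b ≢ three
σ₀ᵇ≢3 true ()
σ₀ᵇ≢3 false ()

σ₂ᵇ≢3 : ∀ b → σ₂ᵇ b ≢ three
σ₂ᵇ≢3 true ()
σ₂ᵇ≢3 false ()

σ₀ᵇ≢σ₂ᵇ : ∀ b → σ₀ᵇ b ≢ σ₂ᵇ b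
σ₀ᵇ≢σ₂ᵇ true ()
σ₀ᵇ≢σ₂ᵇ false ()

σ₀ σ₂ : ℕ → Fin 4
σ₀ x = σ₀ᵇ (even? x)
σ₂ x = σ₂ᵇ (even? x)

-- Columns: the cyclic block cyc i z t (residue z, difference t, level i) and the
-- vertical block vert x over residue x.
data Column : Set where
  cyc : Level → ℕ → ℕ → Column
  vert : ℕ → Column

module Construction (k : ℕ) where
  w m : ℕ
  w = suc k
  m = suc (suc (suc (k + k)))
  open Congruence m

  α β : Level → ℕ
  α l0 = 1
  α l1 = 1
  α l2 = suc (k + k)
  β l0 = suc (suc (k + k))
  β l1 = suc (suc (k + k))
  β l2 = 2

  α+β≡m : ∀ i → α i + β i ≡ m
  α+β≡m l0 = refl
  α+β≡m l1 = refl
  α+β≡m l2 = cong suc (+-comm (k + k) 2)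

  inv2 : Invertible 2
  inv2 = suc (suc k) , 1 , e k
    where
    e : ∀ k → suc (suc k) * 2 ≡ 1 + 1 * suc (suc (suc (k + k)))
    e = solve-∀

  invα : ∀ i → Invertible (α i)
  invα l0 = 1 , 0 , refl
  invα l1 = 1 , 0 , refl
  invα l2 = suc k , k , e k
    where
    e : ∀ k → suc k * suc (k + k) ≡ 1 + k * suc (suc (suc (k + k)))
    e = solve-∀

  invβ : ∀ i → Invertible (β i)
  invβ l0 = β l0 , suc (k + k) , square-of-m-1 k
    where
    square-of-m-1 : ∀ k → suc (suc (k + k)) * suc (suc (k + k)) ≡ 1 + suc (k + k) * suc (suc (suc (k + k)))
    square-of-m-1 = solve-∀
  invβ l1 = invβ l0
  invβ l2 = inv2

  module Opp (i : Level) = OppositeMultipliers (α i) (β i) (α+β≡m i) (invα i) inv2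

  cell : Column → Slot → Point
  cell (cyc i z t) slot₁ = ((z + α i * t) % m , i)
  cell (cyc i z t) slot₂ = ((z + β i * t) % m , i)
  cell (cyc i z t) slot₃ = (z , next i)
  cell (vert x) slot₁ = (x , l0)
  cell (vert x) slot₂ = (x , l1)
  cell (vert x) slot₃ = (x , l2)

  symbol : Column → Slot → Fin 4
  symbol (cyc _ _ _) slot₁ = one
  symbol (cyc _ _ _) slot₂ = two
  symbol (cyc _ _ _) slot₃ = three
  symbol (vert x) slot₁ = σ₀ x
  symbol (vert x) slot₂ = three
  symbol (vert x) slot₃ = σ₂ x

  entry : Column → Point → Fin 4
  entry c p with p ≟ₚ cell c slot₁
  ... | yes _ = symbol c slot₁
  ... | no _ with p ≟ₚ cell c slot₂
  ...   | yes _ = symbol c slot₂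
  ...   | no _ with p ≟ₚ cell c slot₃
  ...     | yes _ = symbol c slot₃
  ...     | no _ = fz

  entry-cases : ∀ c p → (Σ Slot λ s → p ≡ cell c s × entry c p ≡ symbol c s) ⊎ (entry c p ≡ fz × (∀ s → p ≢ cell c s))
  entry-cases c p with p ≟ₚ cell c slot₁
  ... | yes e1 = inj₁ (slot₁ , e1 , refl)
  ... | no n1 with p ≟ₚ cell c slot₂
  ...   | yes e2 = inj₁ (slot₂ , e2 , refl)
  ...   | no n2 with p ≟ₚ cell c slot₃
  ...     | yes e3 = inj₁ (slot₃ , e3 , refl)
  ...     | no n3 = inj₂ (refl , λ { slot₁ → n1 ; slot₂ → n2 ; slot₃ → n3 })

  symbol≢0 : ∀ c s → symbol c s ≢ fz
  symbol≢0 (cyc _ _ _) slot₁ ()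
  symbol≢0 (cyc _ _ _) slot₂ ()
  symbol≢0 (cyc _ _ _) slot₃ ()
  symbol≢0 (vert x) slot₁ = σ₀ᵇ≢0 (even? x)
    where
    σ₀ᵇ≢0 : ∀ b → σ₀ᵇ b ≢ fz
    σ₀ᵇ≢0 true ()
    σ₀ᵇ≢0 false ()
  symbol≢0 (vert x) slot₂ ()
  symbol≢0 (vert x) slot₃ = σ₂ᵇ≢0 (even? x)
    where
    σ₂ᵇ≢0 : ∀ b → σ₂ᵇ b ≢ fz
    σ₂ᵇ≢0 true ()
    σ₂ᵇ≢0 false ()

  symbol-injective : ∀ c s s' → symbol c s ≡ symbol c s' → s ≡ s'
  symbol-injective (cyc _ _ _) slot₁ slot₁ _ = refl
  symbol-injective (cyc _ _ _) slot₂ slot₂ _ = refl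
  symbol-injective (cyc _ _ _) slot₃ slot₃ _ = refl
  symbol-injective (vert x) slot₁ slot₁ _ = refl
  symbol-injective (vert x) slot₂ slot₂ _ = refl
  symbol-injective (vert x) slot₃ slot₃ _ = refl
  symbol-injective (vert x) slot₁ slot₂ e = ⊥-elim (σ₀ᵇ≢3 (even? x) e)
  symbol-injective (vert x) slot₁ slot₃ e = ⊥-elim (σ₀ᵇ≢σ₂ᵇ (even? x) e)
  symbol-injective (vert x) slot₂ slot₁ e = ⊥-elim (σ₀ᵇ≢3 (even? x) (sym e))
  symbol-injective (vert x) slot₂ slot₃ e = ⊥-elim (σ₂ᵇ≢3 (even? x) (sym e))
  symbol-injective (vert x) slot₃ slot₁ e = ⊥-elim (σ₀ᵇ≢σ₂ᵇ (even? x) (sym e))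
  symbol-injective (vert x) slot₃ slot₂ e = ⊥-elim (σ₂ᵇ≢3 (even? x) e)
  symbol-injective (cyc _ _ _) slot₁ slot₂ ()
  symbol-injective (cyc _ _ _) slot₁ slot₃ ()
  symbol-injective (cyc _ _ _) slot₂ slot₁ ()
  symbol-injective (cyc _ _ _) slot₂ slot₃ ()
  symbol-injective (cyc _ _ _) slot₃ slot₁ ()
  symbol-injective (cyc _ _ _) slot₃ slot₂ ()

  InRange : Column → Set
  InRange (cyc i z t) = z < m × 1 ≤ t × t ≤ w
  InRange (vert x) = x < m

  t+t'<m : ∀ {t t'} → t ≤ w → t' ≤ w → t + t' < m
  t+t'<m {t} {t'} t≤w t'≤w = s≤s (subst (t + t' ≤_) (+-suc (suc k) k) (+-mono-≤ t≤w t'≤w))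

  t<m : ∀ {t} → t ≤ w → t < m
  t<m t≤w = ≤-trans (s≤s t≤w) (s≤s (s≤s (≤-trans (m≤m+n k k) (n≤1+n _))))

  CellsDistinct : Column → Set
  CellsDistinct c = ∀ s s' → s ≢ s' → cell c s ≢ cell c s'

  cells-distinct : ∀ c → InRange c → CellsDistinct c
  cells-distinct (cyc i z t) (z<m , 1≤t , t≤w) = distinct
    where
    first≢second : cell (cyc i z t) slot₁ ≢ cell (cyc i z t) slot₂
    first≢second e = Opp.opposite-shifts-differ i z t t 1≤t (t+t'<m t≤w t≤w) (%-≡⇒≈ (cong proj₁ e))
    distinct : CellsDistinct (cyc i z t)
    distinct slot₁ slot₁ ne = ⊥-elim (ne refl)
    distinct slot₂ slot₂ ne = ⊥-elim (ne refl)
    distinct slot₃ slot₃ ne = ⊥-elim (ne refl)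
    distinct slot₁ slot₂ ne = first≢second
    distinct slot₂ slot₁ ne e = first≢second (sym e)
    distinct slot₁ slot₃ ne e = next-≢ i (cong proj₂ e)
    distinct slot₂ slot₃ ne e = next-≢ i (cong proj₂ e)
    distinct slot₃ slot₁ ne e = next-≢ i (cong proj₂ (sym e))
    distinct slot₃ slot₂ ne e = next-≢ i (cong proj₂ (sym e))
  cells-distinct (vert x) _ = distinct
    where
    distinct : CellsDistinct (vert x)
    distinct slot₁ slot₁ ne = ⊥-elim (ne refl)
    distinct slot₂ slot₂ ne = ⊥-elim (ne refl)
    distinct slot₃ slot₃ ne = ⊥-elim (ne refl)
    distinct slot₁ slot₂ ne ()
    distinct slot₁ slot₃ ne ()
    distinct slot₂ slot₁ ne ()
    distinct slot₂ slot₃ ne ()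
    distinct slot₃ slot₁ ne ()
    distinct slot₃ slot₂ ne ()

  entry-χ : ∀ c → CellsDistinct c → ∀ p s → χ (entry c p FP.≟ symbol c s) ≡ χ (p ≟ₚ cell c s)
  entry-χ c distinct p s with entry-cases c p
  ... | inj₁ (s' , p≡cell , entry≡) with s' ≟ₛ s
  ...   | yes refl = trans (χ-yes _ entry≡) (sym (χ-yes _ p≡cell))
  ...   | no s'≢s = trans (χ-no _ (λ e → s'≢s (symbol-injective c s' s (trans (sym entry≡) e))))
                          (sym (χ-no _ (λ e → distinct s' s s'≢s (trans (sym p≡cell) e))))
  entry-χ c distinct p s | inj₂ (entry≡0 , off) =
    trans (χ-no _ (λ e → symbol≢0 c s (trans (sym e) entry≡0))) (sym (χ-no _ (off s)))

  entry-at-cell : ∀ c → CellsDistinct c → ∀ s → entry c (cell c s) ≡ symbol c s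
  entry-at-cell c distinct s with entry-cases c (cell c s)
  ... | inj₁ (s' , cell≡ , entry≡) with s' ≟ₛ s
  ...   | yes refl = entry≡
  ...   | no s'≢s = ⊥-elim (distinct s s' (λ e → s'≢s (sym e)) cell≡)
  entry-at-cell c distinct s | inj₂ (_ , off) = ⊥-elim (off s refl)

  OnColumn : Point → Column → Set
  OnColumn p c = Σ Slot λ s → p ≡ cell c s

  nonzero-on-column : ∀ c p → 1 ≤ nonzero (entry c p) → OnColumn p c
  nonzero-on-column c p h with entry-cases c p
  ... | inj₁ (s , p≡cell , _) = s , p≡cell
  ... | inj₂ (entry≡0 , _) rewrite entry≡0 with h
  ...   | ()

  on-column-nonzero : ∀ c p → OnColumn p c → entry c p ≢ fz
  on-column-nonzero c p (s , p≡cell) with entry-cases c p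
  ... | inj₁ (s' , _ , entry≡) = λ entry≡0 → symbol≢0 c s' (trans (sym entry≡) entry≡0)
  ... | inj₂ (_ , off) = ⊥-elim (off s p≡cell)

  no-repeated-symbol : ∀ c → CellsDistinct c → ∀ p q → p ≢ q → entry c p ≡ entry c q → entry c p ≢ fz → ⊥
  no-repeated-symbol c distinct p q p≢q e nz with entry-cases c p | entry-cases c q
  ... | inj₂ (entry≡0 , _) | _ = nz entry≡0
  ... | inj₁ _ | inj₂ (entry≡0 , _) = nz (trans e entry≡0)
  ... | inj₁ (s , p≡cell , ep) | inj₁ (s' , q≡cell , eq) with symbol-injective c s s' (trans (sym ep) (trans e eq))
  ...   | refl = p≢q (trans p≡cell (sym q≡cell))

  mult : Level → Bool → ℕ
  mult i true = α i
  mult i false = β i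

  inv-mult : ∀ i b → Invertible (mult i b)
  inv-mult i true = invα i
  inv-mult i false = invβ i

  residue : ∀ {p : Point} {a i} → p ≡ (a % m , i) → proj₁ p ≈ a
  residue {a = a} refl = %-≈ a

  data PairView (p q : Point) (i : Level) (z t : ℕ) : Set where
    slots₁₂ : proj₂ p ≡ i → proj₂ q ≡ i → proj₁ p ≈ z + α i * t → proj₁ q ≈ z + β i * t → PairView p q i z t
    slots₂₁ : proj₂ p ≡ i → proj₂ q ≡ i → proj₁ p ≈ z + β i * t → proj₁ q ≈ z + α i * t → PairView p q i z t
    slots-·₃ : (b : Bool) → proj₂ p ≡ i → proj₂ q ≡ next i → proj₁ q ≡ z → proj₁ p ≈ z + mult i b * t → PairView p q i z t
    slots-₃· : (b : Bool) → proj₂ q ≡ i → proj₂ p ≡ next i → proj₁ p ≡ z → proj₁ q ≈ z + mult i b * t → PairView p q i z t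

  pair-view : ∀ p q i z t → p ≢ q → OnColumn p (cyc i z t) → OnColumn q (cyc i z t) → PairView p q i z t
  pair-view p q i z t p≢q (slot₁ , ep) (slot₁ , eq) = ⊥-elim (p≢q (trans ep (sym eq)))
  pair-view p q i z t p≢q (slot₂ , ep) (slot₂ , eq) = ⊥-elim (p≢q (trans ep (sym eq)))
  pair-view p q i z t p≢q (slot₃ , ep) (slot₃ , eq) = ⊥-elim (p≢q (trans ep (sym eq)))
  pair-view p q i z t p≢q (slot₁ , ep) (slot₂ , eq) = slots₁₂ (cong proj₂ ep) (cong proj₂ eq) (residue ep) (residue eq)
  pair-view p q i z t p≢q (slot₂ , ep) (slot₁ , eq) = slots₂₁ (cong proj₂ ep) (cong proj₂ eq) (residue ep) (residue eq)
  pair-view p q i z t p≢q (slot₁ , ep) (slot₃ , eq) = slots-·₃ true (cong proj₂ ep) (cong proj₂ eq) (cong proj₁ eq) (residue ep)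
  pair-view p q i z t p≢q (slot₂ , ep) (slot₃ , eq) = slots-·₃ false (cong proj₂ ep) (cong proj₂ eq) (cong proj₁ eq) (residue ep)
  pair-view p q i z t p≢q (slot₃ , ep) (slot₁ , eq) = slots-₃· true (cong proj₂ eq) (cong proj₂ ep) (cong proj₁ ep) (residue eq)
  pair-view p q i z t p≢q (slot₃ , ep) (slot₂ , eq) = slots-₃· false (cong proj₂ eq) (cong proj₂ ep) (cong proj₁ ep) (residue eq)

  pair-view-level : ∀ {p q i z t i' z' t'} → PairView p q i z t → PairView p q i' z' t' → i ≡ i'
  pair-view-level (slots₁₂ a _ _ _) (slots₁₂ a' _ _ _) = trans (sym a) a'
  pair-view-level (slots₁₂ a _ _ _) (slots₂₁ a' _ _ _) = trans (sym a) a'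
  pair-view-level (slots₁₂ a _ _ _) (slots-·₃ _ a' _ _ _) = trans (sym a) a'
  pair-view-level (slots₁₂ _ a _ _) (slots-₃· _ a' _ _ _) = trans (sym a) a'
  pair-view-level (slots₂₁ a _ _ _) (slots₁₂ a' _ _ _) = trans (sym a) a'
  pair-view-level (slots₂₁ a _ _ _) (slots₂₁ a' _ _ _) = trans (sym a) a'
  pair-view-level (slots₂₁ a _ _ _) (slots-·₃ _ a' _ _ _) = trans (sym a) a'
  pair-view-level (slots₂₁ _ a _ _) (slots-₃· _ a' _ _ _) = trans (sym a) a'
  pair-view-level (slots-·₃ _ a _ _ _) (slots₁₂ a' _ _ _) = trans (sym a) a'
  pair-view-level (slots-·₃ _ a _ _ _) (slots₂₁ a' _ _ _) = trans (sym a) a'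
  pair-view-level (slots-·₃ _ a _ _ _) (slots-·₃ _ a' _ _ _) = trans (sym a) a'
  pair-view-level {i = i} (slots-·₃ _ a b _ _) (slots-₃· _ a' b' _ _) =
    ⊥-elim (next²-≢ i (trans (sym a) (trans b' (cong next (trans (sym a') b)))))
  pair-view-level (slots-₃· _ a _ _ _) (slots₁₂ _ a' _ _) = trans (sym a) a'
  pair-view-level (slots-₃· _ a _ _ _) (slots₂₁ _ a' _ _) = trans (sym a) a'
  pair-view-level {i = i} (slots-₃· _ a b _ _) (slots-·₃ _ a' b' _ _) =
    ⊥-elim (next²-≢ i (trans (sym a) (trans b' (cong next (trans (sym a') b)))))
  pair-view-level (slots-₃· _ a _ _ _) (slots-₃· _ a' _ _ _) = trans (sym a) a'

  same-base-offset : ∀ i {u z t t'} b b' → InRange (cyc i z t) → InRange (cyc i z t') →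
                     u ≈ z + mult i b * t → u ≈ z + mult i b' * t' → t ≡ t'
  same-base-offset i {u} {z} {t} {t'} b b' (z<m , 1≤t , t≤w) (_ , 1≤t' , t'≤w) h h' = compare b b' (≈-trans (≈-sym h) h')
    where
    compare : ∀ b b' → z + mult i b * t ≈ z + mult i b' * t' → t ≡ t'
    compare true true e = shift-injective (invα i) z t t' (t<m t≤w) (t<m t'≤w) e
    compare false false e = shift-injective (invβ i) z t t' (t<m t≤w) (t<m t'≤w) e
    compare true false e = ⊥-elim (Opp.opposite-shifts-differ i z t t' 1≤t (t+t'<m t≤w t'≤w) e)
    compare false true e = ⊥-elim (Opp.opposite-shifts-differ' i z t t' 1≤t' (t+t'<m t≤w t'≤w) e)

  pair-view-determines : ∀ {p q i z t z' t'} → InRange (cyc i z t) → InRange (cyc i z' t') →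
                         PairView p q i z t → PairView p q i z' t' → z ≡ z' × t ≡ t'
  pair-view-determines {i = i} {z} {t} {z'} {t'} r@(z<m , 1≤t , t≤w) r'@(z'<m , 1≤t' , t'≤w) = compare
    where
    determines : ∀ {x y x' y'} → x ≈ x' → y ≈ y' → x ≈ z + α i * t → y ≈ z + β i * t →
                 x' ≈ z' + α i * t' → y' ≈ z' + β i * t' → z ≡ z' × t ≡ t'
    determines x≈x' y≈y' hx hy hx' hy' = Opp.shift-pair-determines i z z' t t' z<m z'<m (t<m t≤w) (t<m t'≤w)
      (≈-trans (≈-sym hx) (≈-trans x≈x' hx')) (≈-trans (≈-sym hy) (≈-trans y≈y' hy'))
    compare : ∀ {p q} → PairView p q i z t → PairView p q i z' t' → z ≡ z' × t ≡ t'
    compare (slots₁₂ _ _ hp hq) (slots₁₂ _ _ hp' hq') = determines ≈-refl ≈-refl hp hq hp' hq'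
    compare (slots₂₁ _ _ hp hq) (slots₂₁ _ _ hp' hq') = determines ≈-refl ≈-refl hq hp hq' hp'
    compare (slots₁₂ _ _ hp hq) (slots₂₁ _ _ hp' hq') = ⊥-elim (Opp.shift-pair-uncrossed i z z' t t' z<m z'<m 1≤t
      (t+t'<m t≤w t'≤w) (≈-trans (≈-sym hp) hp') (≈-trans (≈-sym hq) hq'))
    compare (slots₂₁ _ _ hp hq) (slots₁₂ _ _ hp' hq') = ⊥-elim (Opp.shift-pair-uncrossed i z' z t' t z'<m z<m 1≤t'
      (t+t'<m t'≤w t≤w) (≈-trans (≈-sym hp') hp) (≈-trans (≈-sym hq') hq))
    compare (slots-·₃ b _ _ qz hp) (slots-·₃ b' _ _ qz' hp') with trans (sym qz) qz'
    ... | refl = refl , same-base-offset i b b' r r' hp hp'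
    compare (slots-₃· b _ _ pz hq) (slots-₃· b' _ _ pz' hq') with trans (sym pz) pz'
    ... | refl = refl , same-base-offset i b b' r r' hq hq'
    compare (slots₁₂ _ b _ _) (slots-·₃ _ _ b' _ _) = ⊥-elim (next-≢ i (trans (sym b) b'))
    compare (slots₂₁ _ b _ _) (slots-·₃ _ _ b' _ _) = ⊥-elim (next-≢ i (trans (sym b) b'))
    compare (slots₁₂ a _ _ _) (slots-₃· _ _ a' _ _) = ⊥-elim (next-≢ i (trans (sym a) a'))
    compare (slots₂₁ a _ _ _) (slots-₃· _ _ a' _ _) = ⊥-elim (next-≢ i (trans (sym a) a'))
    compare (slots-·₃ _ _ b' _ _) (slots₁₂ _ b _ _) = ⊥-elim (next-≢ i (trans (sym b) b'))
    compare (slots-·₃ _ _ b' _ _) (slots₂₁ _ b _ _) = ⊥-elim (next-≢ i (trans (sym b) b'))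
    compare (slots-₃· _ _ a' _ _) (slots₁₂ a _ _ _) = ⊥-elim (next-≢ i (trans (sym a) a'))
    compare (slots-₃· _ _ a' _ _) (slots₂₁ a _ _ _) = ⊥-elim (next-≢ i (trans (sym a) a'))
    compare (slots-·₃ _ a _ _ _) (slots-₃· _ _ a' _ _) = ⊥-elim (next-≢ i (trans (sym a) a'))
    compare (slots-₃· _ _ a' _ _) (slots-·₃ _ a _ _ _) = ⊥-elim (next-≢ i (trans (sym a) a'))

  on-vert : ∀ {p x} → OnColumn p (vert x) → proj₁ p ≡ x
  on-vert (slot₁ , e) = cong proj₁ e
  on-vert (slot₂ , e) = cong proj₁ e
  on-vert (slot₃ , e) = cong proj₁ e

  -- Two points of a cyclic block have different residues, so they never share a vertical block.
  cyc-residues-differ : ∀ {p q i z t} → InRange (cyc i z t) → PairView p q i z t → proj₁ p ≡ proj₁ q → ⊥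
  cyc-residues-differ {i = i} {z} {t} (z<m , 1≤t , t≤w) (slots₁₂ _ _ hp hq) e =
    Opp.opposite-shifts-differ i z t t 1≤t (t+t'<m t≤w t≤w) (≈-trans (≈-sym hp) (≈-trans (≈-reflexive e) hq))
  cyc-residues-differ {i = i} {z} {t} (z<m , 1≤t , t≤w) (slots₂₁ _ _ hp hq) e =
    Opp.opposite-shifts-differ' i z t t 1≤t (t+t'<m t≤w t≤w) (≈-trans (≈-sym hp) (≈-trans (≈-reflexive e) hq))
  cyc-residues-differ {i = i} {z} {t} (z<m , 1≤t , t≤w) (slots-·₃ b _ _ qz hp) e =
    shift-moves (inv-mult i b) z t 1≤t (t<m t≤w) (≈-trans (≈-sym hp) (≈-reflexive (trans e qz)))
  cyc-residues-differ {i = i} {z} {t} (z<m , 1≤t , t≤w) (slots-₃· b _ _ pz hq) e =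
    shift-moves (inv-mult i b) z t 1≤t (t<m t≤w) (≈-trans (≈-sym hq) (≈-reflexive (trans (sym e) pz)))

  packing : ∀ p q c c' → p ≢ q → InRange c → InRange c' →
            OnColumn p c → OnColumn q c → OnColumn p c' → OnColumn q c' → c ≡ c'
  packing p q (cyc i z t) (cyc i' z' t') p≢q r r' p∈c q∈c p∈c' q∈c'
    with pair-view p q i z t p≢q p∈c q∈c | pair-view p q i' z' t' p≢q p∈c' q∈c'
  ... | v | v' with pair-view-level v v'
  ...   | refl with pair-view-determines r r' v v'
  ...     | refl , refl = refl
  packing p q (cyc i z t) (vert x) p≢q r r' p∈c q∈c p∈c' q∈c' =
    ⊥-elim (cyc-residues-differ r (pair-view p q i z t p≢q p∈c q∈c) (trans (on-vert p∈c') (sym (on-vert q∈c'))))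
  packing p q (vert x) (cyc i z t) p≢q r r' p∈c q∈c p∈c' q∈c' =
    ⊥-elim (cyc-residues-differ r' (pair-view p q i z t p≢q p∈c' q∈c') (trans (on-vert p∈c) (sym (on-vert q∈c))))
  packing p q (vert x) (vert x') p≢q r r' p∈c q∈c p∈c' q∈c' = cong vert (trans (sym (on-vert p∈c)) (on-vert p∈c'))

  sumOver : (Column → ℕ) → List Column → ℕ
  sumOver g [] = 0
  sumOver g (c ∷ cs) = g c + sumOver g cs

  sumOver-++ : ∀ g xs ys → sumOver g (xs ++ ys) ≡ sumOver g xs + sumOver g ys
  sumOver-++ g [] ys = refl
  sumOver-++ g (x ∷ xs) ys = trans (cong (g x +_) (sumOver-++ g xs ys)) (sym (+-assoc (g x) _ _))

  sumOver-+ : ∀ f h xs → sumOver (λ c → f c + h c) xs ≡ sumOver f xs + sumOver h xs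
  sumOver-+ f h [] = refl
  sumOver-+ f h (c ∷ cs) rewrite sumOver-+ f h cs = swap-middle (f c) (h c) _ _

  sumOver-mono : ∀ {P : Column → Set} f h xs → All P xs → (∀ c → P c → f c ≤ h c) → sumOver f xs ≤ sumOver h xs
  sumOver-mono f h [] [] le = z≤n
  sumOver-mono f h (c ∷ cs) (pc ∷ pcs) le = +-mono-≤ (le c pc) (sumOver-mono f h cs pcs le)

  sumOver-1 : ∀ xs → sumOver (λ _ → 1) xs ≡ length xs
  sumOver-1 [] = refl
  sumOver-1 (c ∷ cs) = cong suc (sumOver-1 cs)

  sumOver-applyUpTo : ∀ g N h → sumOver g (applyUpTo h N) ≡ sumBelow N (λ i → g (h i))
  sumOver-applyUpTo g zero h = refl
  sumOver-applyUpTo g (suc N) h = cong (g (h 0) +_) (sumOver-applyUpTo g N (λ i → h (suc i)))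

  sumOver-concat : ∀ g N (hs : ℕ → List Column) → sumOver g (L.concat (applyUpTo hs N)) ≡ sumBelow N (λ i → sumOver g (hs i))
  sumOver-concat g zero hs = refl
  sumOver-concat g (suc N) hs =
    trans (sumOver-++ g (hs 0) _) (cong (sumOver g (hs 0) +_) (sumOver-concat g N (λ i → hs (suc i))))

  level-columns : Level → List Column
  level-columns i = L.concat (applyUpTo (λ t' → applyUpTo (λ z → cyc i z (suc t')) m) w)

  all-columns : List Column
  all-columns = level-columns l0 ++ (level-columns l1 ++ (level-columns l2 ++ applyUpTo vert m))

  level-sum : Level → (Column → ℕ) → ℕ
  level-sum i f = sumBelow w (λ t' → sumBelow m (λ z → f (cyc i z (suc t'))))

  vert-sum : (Column → ℕ) → ℕ
  vert-sum f = sumBelow m (λ x → f (vert x))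

  sumOver-all-columns : ∀ f → sumOver f all-columns ≡ level-sum l0 f + (level-sum l1 f + (level-sum l2 f + vert-sum f))
  sumOver-all-columns f =
    trans (sumOver-++ f (level-columns l0) _) (cong₂ _+_ (sumOver-level l0)
      (trans (sumOver-++ f (level-columns l1) _) (cong₂ _+_ (sumOver-level l1)
        (trans (sumOver-++ f (level-columns l2) _) (cong₂ _+_ (sumOver-level l2) (sumOver-applyUpTo f m vert))))))
    where
    sumOver-level : ∀ i → sumOver f (level-columns i) ≡ level-sum i f
    sumOver-level i = trans (sumOver-concat f w (λ t' → applyUpTo (λ z → cyc i z (suc t')) m))
      (sumBelow-cong w _ _ (λ t' _ → sumOver-applyUpTo f m (λ z → cyc i z (suc t'))))

  all-columns-in-range : All InRange all-columns
  all-columns-in-range =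
    All.++⁺ (level l0) (All.++⁺ (level l1) (All.++⁺ (level l2) (All.applyUpTo⁺₁ vert m (λ x<m → x<m))))
    where
    level : ∀ i → All InRange (level-columns i)
    level i = All.concat⁺ (All.applyUpTo⁺₁ (λ t' → applyUpTo (λ z → cyc i z (suc t')) m) w
                (λ t'<w → All.applyUpTo⁺₁ (λ z → cyc i z (suc _)) m (λ z<m → z<m , s≤s z≤n , t'<w)))

  exclusive-sum-≤1 : ∀ a b → a ≤ 1 → b ≤ 1 → (1 ≤ a → 1 ≤ b → ⊥) → a + b ≤ 1
  exclusive-sum-≤1 zero b _ b≤1 _ = b≤1
  exclusive-sum-≤1 (suc a) zero a≤1 _ _ = subst (_≤ 1) (sym (+-identityʳ (suc a))) a≤1
  exclusive-sum-≤1 (suc a) (suc b) _ _ exclusive = ⊥-elim (exclusive (s≤s z≤n) (s≤s z≤n))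

  positive-sum : ∀ a b → 1 ≤ a + b → 1 ≤ a ⊎ 1 ≤ b
  positive-sum zero b h = inj₂ h
  positive-sum (suc a) b h = inj₁ (s≤s z≤n)

  -- The position of a column in all-columns: its level, or 3 for a vertical block.
  rank : Column → ℕ
  rank (cyc l0 _ _) = 0
  rank (cyc l1 _ _) = 1
  rank (cyc l2 _ _) = 2
  rank (vert _) = 3

  -- A 0/1-valued function that is positive on at most one column in range sums to at
  -- most 1 over all columns (the blocks of the design are listed without repetition).
  module AtMostOne (F : Column → ℕ) (F≤1 : ∀ c → F c ≤ 1)
                   (unique : ∀ c c' → InRange c → InRange c' → 1 ≤ F c → 1 ≤ F c' → c ≡ c') where

    Witness : ℕ → Set
    Witness r = Σ Column λ c → InRange c × 1 ≤ F c × r ≤ rank c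

    level-witness : ∀ i → 1 ≤ level-sum i F → Σ ℕ λ z → Σ ℕ λ t → InRange (cyc i z t) × 1 ≤ F (cyc i z t)
    level-witness i pos with sumBelow-positive w _ pos
    ... | t' , t'<w , pos' with sumBelow-positive m _ pos'
    ...   | z , z<m , Fc = z , suc t' , (z<m , s≤s z≤n , t'<w) , Fc

    level-sum-≤1 : ∀ i → level-sum i F ≤ 1
    level-sum-≤1 i = sumBelow-≤1 w _ one-per-difference one-difference
      where
      one-per-difference : ∀ t' → t' < w → sumBelow m (λ z → F (cyc i z (suc t'))) ≤ 1
      one-per-difference t' t'<w = sumBelow-≤1 m _ (λ z _ → F≤1 _)
        (λ z z' z<m z'<m Fc Fc' → cyc-residue (unique _ _ (z<m , s≤s z≤n , t'<w) (z'<m , s≤s z≤n , t'<w) Fc Fc'))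
        where
        cyc-residue : ∀ {z z'} → cyc i z (suc t') ≡ cyc i z' (suc t') → z ≡ z'
        cyc-residue refl = refl
      one-difference : ∀ t' t'' → t' < w → t'' < w → 1 ≤ sumBelow m (λ z → F (cyc i z (suc t'))) →
                       1 ≤ sumBelow m (λ z → F (cyc i z (suc t''))) → t' ≡ t''
      one-difference t' t'' t'<w t''<w pos pos' with sumBelow-positive m _ pos | sumBelow-positive m _ pos'
      ... | z , z<m , Fc | z' , z'<m , Fc' = cyc-difference (unique _ _ (z<m , s≤s z≤n , t'<w) (z'<m , s≤s z≤n , t''<w) Fc Fc')
        where
        cyc-difference : cyc i z (suc t') ≡ cyc i z' (suc t'') → t' ≡ t''
        cyc-difference refl = refl

    vert-sum-≤1 : vert-sum F ≤ 1
    vert-sum-≤1 = sumBelow-≤1 m _ (λ x _ → F≤1 _) (λ x x' x<m x'<m Fc Fc' → vert-residue (unique _ _ x<m x'<m Fc Fc'))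
      where
      vert-residue : ∀ {x x'} → vert x ≡ vert x' → x ≡ x'
      vert-residue refl = refl

    from-level : ∀ i → 1 ≤ level-sum i F → Witness (rank (cyc i 0 0))
    from-level l0 pos with level-witness l0 pos
    ... | z , t , r , Fc = cyc l0 z t , r , Fc , ≤-refl
    from-level l1 pos with level-witness l1 pos
    ... | z , t , r , Fc = cyc l1 z t , r , Fc , ≤-refl
    from-level l2 pos with level-witness l2 pos
    ... | z , t , r , Fc = cyc l2 z t , r , Fc , ≤-refl

    from-vert : 1 ≤ vert-sum F → Witness 3
    from-vert pos with sumBelow-positive m _ pos
    ... | x , x<m , Fc = vert x , x<m , Fc , ≤-refl

    weaken : ∀ {r r'} → r ≤ r' → Witness r' → Witness r
    weaken r≤r' (c , rc , Fc , r'≤) = c , rc , Fc , ≤-trans r≤r' r'≤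

    from-suffix₂ : 1 ≤ level-sum l2 F + vert-sum F → Witness 2
    from-suffix₂ pos with positive-sum (level-sum l2 F) _ pos
    ... | inj₁ pos₂ = from-level l2 pos₂
    ... | inj₂ pos₃ = weaken (n≤1+n 2) (from-vert pos₃)

    from-suffix₁ : 1 ≤ level-sum l1 F + (level-sum l2 F + vert-sum F) → Witness 1
    from-suffix₁ pos with positive-sum (level-sum l1 F) _ pos
    ... | inj₁ pos₁ = from-level l1 pos₁
    ... | inj₂ pos₂ = weaken (n≤1+n 1) (from-suffix₂ pos₂)

    apart : ∀ i {s} → (1 ≤ s → Witness (suc (rank (cyc i 0 0)))) → 1 ≤ level-sum i F → 1 ≤ s → ⊥
    apart i suffix pos pos' with level-witness i pos | suffix pos'
    ... | z , t , r , Fc | c' , r' , Fc' , rank< with unique _ _ r r' Fc Fc'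
    ...   | refl = <-irrefl (same-rank i) rank<
      where
      same-rank : ∀ i → rank (cyc i 0 0) ≡ rank (cyc i z t)
      same-rank l0 = refl
      same-rank l1 = refl
      same-rank l2 = refl

    total : sumOver F all-columns ≤ 1
    total = subst (_≤ 1) (sym (sumOver-all-columns F))
      (exclusive-sum-≤1 _ _ (level-sum-≤1 l0)
        (exclusive-sum-≤1 _ _ (level-sum-≤1 l1)
          (exclusive-sum-≤1 _ _ (level-sum-≤1 l2) vert-sum-≤1 (apart l2 from-vert))
          (apart l1 from-suffix₂))
        (apart l0 from-suffix₁))

  translate-hits-once : ∀ u K → u < m → sumBelow m (λ z → χ (u ≟ (z + K) % m)) ≡ 1
  translate-hits-once u K u<m = sumBelow-χ-unique m (λ z → u ≟ (z + K) % m) z₀ (m%n<n (u + (m ∸ K % m)) m) u≡z₀+K unique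
    where
    z₀ = (u + (m ∸ K % m)) % m
    z₀+K≈u : z₀ + K ≈ u
    z₀+K≈u = ≈-trans (≈-+ (%-≈ (u + (m ∸ K % m))) (≈-sym (%-≈ K)))
      (≈-trans (≈-reflexive (trans (+-assoc u _ _) (cong (u +_) (m∸n+n≡m (<⇒≤ (m%n<n K m))))))
        (≈-trans (≈-+ (≈-refl {u}) m≈0) (≈-reflexive (+-identityʳ u))))
    u≡z₀+K : u ≡ (z₀ + K) % m
    u≡z₀+K = ≈-residue u<m (m%n<n (z₀ + K) m) (≈-trans (≈-sym z₀+K≈u) (≈-sym (%-≈ (z₀ + K))))
    unique : ∀ z → z < m → u ≡ (z + K) % m → z ≡ z₀
    unique z z<m e = ≈-residue z<m (m%n<n (u + (m ∸ K % m)) m) (≈-cancelʳ K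
      (≈-trans (≈-sym (%-≈ _)) (≈-trans (≈-reflexive (trans (sym e) u≡z₀+K)) (%-≈ _))))

  χ-point : ∀ u j a i → χ ((u , j) ≟ₚ (a , i)) ≡ χ (j ≟ℓ i) * χ (u ≟ a)
  χ-point u j a i = split (j ≟ℓ i) (u ≟ a)
    where
    split : (j? : Dec (j ≡ i)) (u? : Dec (u ≡ a)) → χ ((u , j) ≟ₚ (a , i)) ≡ χ j? * χ u?
    split (yes j≡i) (yes u≡a) = χ-yes ((u , j) ≟ₚ (a , i)) (cong₂ _,_ u≡a j≡i)
    split (yes _) (no u≢a) = χ-no ((u , j) ≟ₚ (a , i)) (λ e → u≢a (cong proj₁ e))
    split (no j≢i) _ = χ-no ((u , j) ≟ₚ (a , i)) (λ e → j≢i (cong proj₂ e))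

  cyc-symbol : Slot → Fin 4
  cyc-symbol slot₁ = one
  cyc-symbol slot₂ = two
  cyc-symbol slot₃ = three

  cyc-symbol-eq : ∀ i z t s → symbol (cyc i z t) s ≡ cyc-symbol s
  cyc-symbol-eq i z t slot₁ = refl
  cyc-symbol-eq i z t slot₂ = refl
  cyc-symbol-eq i z t slot₃ = refl

  cyc-symbol≢0 : ∀ s → cyc-symbol s ≢ fz
  cyc-symbol≢0 slot₁ ()
  cyc-symbol≢0 slot₂ ()
  cyc-symbol≢0 slot₃ ()

  slot-level : Slot → Level → Level
  slot-level slot₁ i = i
  slot-level slot₂ i = i
  slot-level slot₃ i = next i

  slot-residue : Slot → Level → ℕ → ℕ → ℕ
  slot-residue slot₁ i z t = (z + α i * t) % m
  slot-residue slot₂ i z t = (z + β i * t) % m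
  slot-residue slot₃ i z t = z

  cell-cyc : ∀ s i z t → cell (cyc i z t) s ≡ (slot-residue s i z t , slot-level s i)
  cell-cyc slot₁ i z t = refl
  cell-cyc slot₂ i z t = refl
  cell-cyc slot₃ i z t = refl

  χ-entry-cyc : ∀ u j s i z t → InRange (cyc i z t) →
                χ (entry (cyc i z t) (u , j) FP.≟ cyc-symbol s) ≡ χ (j ≟ℓ slot-level s i) * χ (u ≟ slot-residue s i z t)
  χ-entry-cyc u j s i z t r = begin
    χ (entry (cyc i z t) (u , j) FP.≟ cyc-symbol s)
      ≡⟨ cong (λ v → χ (entry (cyc i z t) (u , j) FP.≟ v)) (sym (cyc-symbol-eq i z t s)) ⟩
    χ (entry (cyc i z t) (u , j) FP.≟ symbol (cyc i z t) s)
      ≡⟨ entry-χ (cyc i z t) (cells-distinct _ r) (u , j) s ⟩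
    χ ((u , j) ≟ₚ cell (cyc i z t) s)
      ≡⟨ cong (λ v → χ ((u , j) ≟ₚ v)) (cell-cyc s i z t) ⟩
    χ ((u , j) ≟ₚ (slot-residue s i z t , slot-level s i))
      ≡⟨ χ-point u j _ _ ⟩
    χ (j ≟ℓ slot-level s i) * χ (u ≟ slot-residue s i z t) ∎
    where open ≡-Reasoning

  sum-slot-residue : ∀ u s i t → u < m → sumBelow m (λ z → χ (u ≟ slot-residue s i z t)) ≡ 1
  sum-slot-residue u slot₁ i t u<m = translate-hits-once u (α i * t) u<m
  sum-slot-residue u slot₂ i t u<m = translate-hits-once u (β i * t) u<m
  sum-slot-residue u slot₃ i t u<m = sumBelow-χ-unique m (λ z → u ≟ z) u u<m refl (λ z _ e → sym e)

  level-symbol-count : ∀ u j s i → u < m →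
    level-sum i (λ c → χ (entry c (u , j) FP.≟ cyc-symbol s)) ≡ w * χ (j ≟ℓ slot-level s i)
  level-symbol-count u j s i u<m =
    trans (sumBelow-cong w _ _ per-difference) (trans (sumBelow-const w _) (cong (w *_) (*-identityʳ _)))
    where
    per-difference : ∀ t' → t' < w →
      sumBelow m (λ z → χ (entry (cyc i z (suc t')) (u , j) FP.≟ cyc-symbol s)) ≡ χ (j ≟ℓ slot-level s i) * 1
    per-difference t' t'<w =
      trans (sumBelow-cong m _ _ (λ z z<m → χ-entry-cyc u j s i z (suc t') (z<m , s≤s z≤n , t'<w)))
        (trans (sumBelow-*ˡ m (χ (j ≟ℓ slot-level s i)) (λ z → χ (u ≟ slot-residue s i z (suc t'))))
          (cong (χ (j ≟ℓ slot-level s i) *_) (sum-slot-residue u s i (suc t') u<m)))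

  χ-entry-off-column : ∀ c p s → (∀ s' → p ≢ cell c s') → χ (entry c p FP.≟ cyc-symbol s) ≡ 0
  χ-entry-off-column c p s off with entry-cases c p
  ... | inj₁ (s' , e , _) = ⊥-elim (off s' e)
  ... | inj₂ (entry≡0 , _) = χ-no (entry c p FP.≟ cyc-symbol s) (λ e → cyc-symbol≢0 s (trans (sym e) entry≡0))

  vert-symbol-count : ∀ u j s → u < m →
    vert-sum (λ c → χ (entry c (u , j) FP.≟ cyc-symbol s)) ≡ χ (entry (vert u) (u , j) FP.≟ cyc-symbol s)
  vert-symbol-count u j s u<m =
    sumBelow-single m _ u u<m (λ x x<m x≢u → χ-entry-off-column (vert x) (u , j) s (λ s' e → x≢u (sym (on-vert (s' , e)))))

  sum-over-levels : ∀ s j x →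
    w * χ (j ≟ℓ slot-level s l0) + (w * χ (j ≟ℓ slot-level s l1) + (w * χ (j ≟ℓ slot-level s l2) + x)) ≡ w + x
  sum-over-levels slot₁ l0 x rewrite *-identityʳ k | *-zeroʳ k = refl
  sum-over-levels slot₁ l1 x rewrite *-identityʳ k | *-zeroʳ k = refl
  sum-over-levels slot₁ l2 x rewrite *-identityʳ k | *-zeroʳ k = refl
  sum-over-levels slot₂ l0 x rewrite *-identityʳ k | *-zeroʳ k = refl
  sum-over-levels slot₂ l1 x rewrite *-identityʳ k | *-zeroʳ k = refl
  sum-over-levels slot₂ l2 x rewrite *-identityʳ k | *-zeroʳ k = refl
  sum-over-levels slot₃ l0 x rewrite *-identityʳ k | *-zeroʳ k = refl
  sum-over-levels slot₃ l1 x rewrite *-identityʳ k | *-zeroʳ k = refl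
  sum-over-levels slot₃ l2 x rewrite *-identityʳ k | *-zeroʳ k = refl

  all-columns-symbol-count : ∀ u j s → u < m →
    sumOver (λ c → χ (entry c (u , j) FP.≟ cyc-symbol s)) all-columns ≡ w + χ (entry (vert u) (u , j) FP.≟ cyc-symbol s)
  all-columns-symbol-count u j s u<m =
    trans (sumOver-all-columns (λ c → χ (entry c (u , j) FP.≟ cyc-symbol s)))
      (trans (cong₂ _+_ (level-symbol-count u j s l0 u<m) (cong₂ _+_ (level-symbol-count u j s l1 u<m)
               (cong₂ _+_ (level-symbol-count u j s l2 u<m) (vert-symbol-count u j s u<m))))
        (sum-over-levels s j (χ (entry (vert u) (u , j) FP.≟ cyc-symbol s))))

  ∞ : Point
  ∞ = (0 , l0)

  avoids∞ : (c : Column) → Dec (entry c ∞ ≡ fz)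
  avoids∞ c = entry c ∞ FP.≟ fz

  columns : List Column
  columns = L.filter avoids∞ all-columns

  columns-in-range : All InRange columns
  columns-in-range = All.filter⁺ avoids∞ all-columns-in-range

  through∞ : (Column → ℕ) → Column → ℕ
  through∞ g c with avoids∞ c
  ... | yes _ = 0
  ... | no _ = g c

  sumOver-filter-∞ : ∀ g xs → sumOver g (L.filter avoids∞ xs) + sumOver (through∞ g) xs ≡ sumOver g xs
  sumOver-filter-∞ g [] = refl
  sumOver-filter-∞ g (c ∷ cs) with avoids∞ c
  ... | yes _ = trans (+-assoc (g c) _ _) (cong (g c +_) (sumOver-filter-∞ g cs))
  ... | no _ = begin
    sumOver g (L.filter avoids∞ cs) + (g c + sumOver (through∞ g) cs)
      ≡⟨ sym (+-assoc (sumOver g (L.filter avoids∞ cs)) (g c) _) ⟩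
    sumOver g (L.filter avoids∞ cs) + g c + sumOver (through∞ g) cs
      ≡⟨ cong (_+ sumOver (through∞ g) cs) (+-comm _ (g c)) ⟩
    g c + sumOver g (L.filter avoids∞ cs) + sumOver (through∞ g) cs
      ≡⟨ +-assoc (g c) _ _ ⟩
    g c + (sumOver g (L.filter avoids∞ cs) + sumOver (through∞ g) cs)
      ≡⟨ cong (g c +_) (sumOver-filter-∞ g cs) ⟩
    g c + sumOver g cs ∎
    where open ≡-Reasoning

  sumOver-columns-≤ : ∀ g → sumOver g columns ≤ sumOver g all-columns
  sumOver-columns-≤ g = subst (sumOver g columns ≤_) (sumOver-filter-∞ g all-columns) (m≤m+n _ _)

  through∞-keeps : ∀ g c s → ∞ ≡ cell c s → through∞ g c ≡ g c
  through∞-keeps g c s ∞≡cell with avoids∞ c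
  ... | yes entry≡0 = ⊥-elim (on-column-nonzero c ∞ (s , ∞≡cell) entry≡0)
  ... | no _ = refl

  through∞-zero : ∀ g c → (∀ s → ∞ ≢ cell c s) → through∞ g c ≡ 0
  through∞-zero g c off with avoids∞ c
  ... | yes _ = refl
  ... | no entry≢0 with entry-cases c ∞
  ...   | inj₁ (s , e , _) = ⊥-elim (off s e)
  ...   | inj₂ (entry≡0 , _) = ⊥-elim (entry≢0 entry≡0)

  m∸t<m : ∀ {t} → 1 ≤ t → m ∸ t < m
  m∸t<m {suc t} _ = s≤s (m∸n≤m _ t)

  t≤m : ∀ {t} → t ≤ w → t ≤ m
  t≤m t≤w = ≤-trans (n≤1+n _) (t<m t≤w)

  -- The blocks through ∞: on level 0, cyc t t (∞ in slot 2) and cyc (m-t) t (∞ in slot 1);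
  -- on level 2, cyc 0 t (∞ in slot 3); and vert 0.
  ∞-on-level0 : ∀ z t → z < m → 1 ≤ t → t ≤ w → ∀ s → ∞ ≡ cell (cyc l0 z t) s → z ≡ t ⊎ z ≡ m ∸ t
  ∞-on-level0 z t z<m 1≤t t≤w slot₁ e = inj₂ (≈-residue z<m (m∸t<m 1≤t) (≈-cancelʳ t (begin
    z + t          ≡⟨ cong (z +_) (sym (*-identityˡ t)) ⟩
    z + 1 * t      ≈⟨ %-≡⇒≈ (sym (cong proj₁ e)) ⟩
    0              ≈⟨ ≈-sym m≈0 ⟩
    m              ≡⟨ sym (m∸n+n≡m (t≤m t≤w)) ⟩
    m ∸ t + t      ∎)))
    where open ≈-Reasoning
  ∞-on-level0 z t z<m 1≤t t≤w slot₂ e = inj₁ (≈-residue z<m (t<m t≤w) (≈-cancelʳ (β l0 * t) (begin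
    z + β l0 * t   ≈⟨ %-≡⇒≈ (sym (cong proj₁ e)) ⟩
    0              ≈⟨ ≈-sym (m*≈0 t) ⟩
    m * t          ≡⟨ refl ⟩
    t + β l0 * t   ∎)))
    where open ≈-Reasoning
  ∞-on-level0 z t z<m 1≤t t≤w slot₃ e = ⊥-elim (l0≢l1 (cong proj₂ e))

  ∞-at-slot₂ : ∀ t → ∞ ≡ cell (cyc l0 t t) slot₂
  ∞-at-slot₂ t = cong₂ _,_ (sym (trans (cong (_% m) (*-comm m t)) (m*n%n≡0 t m))) refl

  ∞-at-slot₁ : ∀ t → t ≤ m → ∞ ≡ cell (cyc l0 (m ∸ t) t) slot₁
  ∞-at-slot₁ t t≤m = cong₂ _,_
    (sym (trans (cong (λ v → (m ∸ t + v) % m) (*-identityˡ t)) (trans (cong (_% m) (m∸n+n≡m t≤m)) (n%n≡0 m)))) refl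

  t≢m∸t : ∀ {t} → t ≤ w → t ≢ m ∸ t
  t≢m∸t {t} t≤w e = <-irrefl (trans (cong (_+ t) e) (m∸n+n≡m (t≤m t≤w))) (t+t'<m t≤w t≤w)

  through∞-level0 : ∀ g z t → z < m → 1 ≤ t → t ≤ w →
    through∞ g (cyc l0 z t) ≡ χ (z ≟ t) * g (cyc l0 z t) + χ (z ≟ m ∸ t) * g (cyc l0 z t)
  through∞-level0 g z t z<m 1≤t t≤w with z ≟ t | z ≟ m ∸ t
  ... | yes z≡t | yes z≡m∸t = ⊥-elim (t≢m∸t t≤w (trans (sym z≡t) z≡m∸t))
  ... | yes refl | no _ =
    trans (through∞-keeps g (cyc l0 z z) slot₂ (∞-at-slot₂ z)) (sym (trans (+-identityʳ _) (+-identityʳ _)))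
  ... | no _ | yes refl =
    trans (through∞-keeps g (cyc l0 (m ∸ t) t) slot₁ (∞-at-slot₁ t (t≤m t≤w))) (sym (+-identityʳ _))
  ... | no z≢t | no z≢m∸t = through∞-zero g _ (λ s e → [ z≢t , z≢m∸t ]′ (∞-on-level0 z t z<m 1≤t t≤w s e))

  ∞-not-on-level1 : ∀ z t s → ∞ ≢ cell (cyc l1 z t) s
  ∞-not-on-level1 z t slot₁ e = l0≢l1 (cong proj₂ e)
  ∞-not-on-level1 z t slot₂ e = l0≢l1 (cong proj₂ e)
  ∞-not-on-level1 z t slot₃ e = l0≢l2 (cong proj₂ e)

  ∞-not-on-level2 : ∀ z t → z ≢ 0 → ∀ s → ∞ ≢ cell (cyc l2 z t) s
  ∞-not-on-level2 z t z≢0 slot₁ e = l0≢l2 (cong proj₂ e)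
  ∞-not-on-level2 z t z≢0 slot₂ e = l0≢l2 (cong proj₂ e)
  ∞-not-on-level2 z t z≢0 slot₃ e = z≢0 (sym (cong proj₁ e))

  ∞-not-on-vert : ∀ x → x ≢ 0 → ∀ s → ∞ ≢ cell (vert x) s
  ∞-not-on-vert x x≢0 slot₁ e = x≢0 (sym (cong proj₁ e))
  ∞-not-on-vert x x≢0 slot₂ e = x≢0 (sym (cong proj₁ e))
  ∞-not-on-vert x x≢0 slot₃ e = x≢0 (sym (cong proj₁ e))

  through∞-sum : ∀ g → sumOver (through∞ g) all-columns ≡
    sumBelow w (λ t' → g (cyc l0 (suc t') (suc t')) + g (cyc l0 (m ∸ suc t') (suc t')))
      + (0 + (sumBelow w (λ t' → g (cyc l2 0 (suc t'))) + g (vert 0)))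
  through∞-sum g = trans (sumOver-all-columns (through∞ g)) (cong₂ _+_ level0 (cong₂ _+_ level1 (cong₂ _+_ level2 vertical)))
    where
    level0 : level-sum l0 (through∞ g) ≡ sumBelow w (λ t' → g (cyc l0 (suc t') (suc t')) + g (cyc l0 (m ∸ suc t') (suc t')))
    level0 = sumBelow-cong w _ _ λ t' t'<w →
      trans (sumBelow-cong m _ _ (λ z z<m → through∞-level0 g z (suc t') z<m (s≤s z≤n) t'<w))
        (trans (sumBelow-+ m (λ z → χ (z ≟ suc t') * g (cyc l0 z (suc t'))) (λ z → χ (z ≟ m ∸ suc t') * g (cyc l0 z (suc t'))))
          (cong₂ _+_ (sumBelow-pick m (suc t') (λ z → g (cyc l0 z (suc t'))) (t<m t'<w))
                     (sumBelow-pick m (m ∸ suc t') (λ z → g (cyc l0 z (suc t'))) (m∸t<m {suc t'} (s≤s z≤n)))))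
    level1 : level-sum l1 (through∞ g) ≡ 0
    level1 = sumBelow-zero w _ (λ t' _ → sumBelow-zero m _ (λ z _ → through∞-zero g _ (∞-not-on-level1 z (suc t'))))
    level2 : level-sum l2 (through∞ g) ≡ sumBelow w (λ t' → g (cyc l2 0 (suc t')))
    level2 = sumBelow-cong w _ _ λ t' t'<w →
      trans (sumBelow-single m _ 0 (s≤s z≤n) (λ z _ z≢0 → through∞-zero g _ (∞-not-on-level2 z (suc t') z≢0)))
        (through∞-keeps g (cyc l2 0 (suc t')) slot₃ refl)
    vertical : vert-sum (through∞ g) ≡ g (vert 0)
    vertical = trans (sumBelow-single m _ 0 (s≤s z≤n) (λ x _ x≢0 → through∞-zero g _ (∞-not-on-vert x x≢0)))
      (through∞-keeps g (vert 0) slot₁ refl)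

  double-below-w : ∀ {h} → h + h ≤ k + k → h < w
  double-below-w {h} le with h ≤? k
  ... | yes h≤k = s≤s h≤k
  ... | no h≰k = ⊥-elim (<-irrefl refl (≤-<-trans le (+-mono-< (≰⇒> h≰k) (≰⇒> h≰k))))

  double-at-most-k : ∀ {h} → h + h ≤ suc (k + k) → h ≤ k
  double-at-most-k {h} le with h ≤? k
  ... | yes h≤k = h≤k
  ... | no h≰k = ⊥-elim (<-irrefl refl (≤-<-trans le (subst (_≤ h + h) (+-suc (suc k) k) (+-mono-≤ (≰⇒> h≰k) (≰⇒> h≰k)))))

  even-count : ∀ u → u < m → sumBelow w (λ t' → χ (u ≟ suc t' + suc t')) + χ (u ≟ 0) ≡ bit (even? u)
  even-count u u<m with double-or-odd u
  ... | inj₁ (zero , refl) = cong (_+ 1) (sumBelow-χ-none w (λ t' → 0 ≟ suc t' + suc t') (λ t' _ ()))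
  ... | inj₁ (suc h , refl) = trans (cong₂ _+_ once (χ-no (suc h + suc h ≟ 0) (λ ()))) (cong bit (sym (even?-double (suc h))))
    where
    h<w : h < w
    h<w = double-below-w (≤-pred (subst (_≤ suc (k + k)) (+-suc h h) (≤-pred (≤-pred u<m))))
    once : sumBelow w (λ t' → χ (suc h + suc h ≟ suc t' + suc t')) ≡ 1
    once = sumBelow-χ-unique w (λ t' → suc h + suc h ≟ suc t' + suc t') h h<w refl
             (λ t' _ e → sym (suc-injective (double-injective e)))
  ... | inj₂ (h , refl) = trans (cong₂ _+_ (sumBelow-χ-none w (λ t' → suc (h + h) ≟ suc t' + suc t')
                                                               (λ t' _ e → double≢odd (suc t') h (sym e)))
                                         (χ-no (suc (h + h) ≟ 0) (λ ())))
                                (cong bit (sym (even?-odd h)))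

  m-minus-double : ∀ t' → t' < w → m ∸ (suc t' + suc t') ≡ suc ((k ∸ t') + (k ∸ t'))
  m-minus-double t' (s≤s t'≤k) = begin
    m ∸ (suc t' + suc t')
      ≡⟨ cong (λ K → suc (suc (suc (K + K))) ∸ (suc t' + suc t')) (sym (m+[n∸m]≡n t'≤k)) ⟩
    suc (suc (suc ((t' + d) + (t' + d)))) ∸ (suc t' + suc t')
      ≡⟨ cong (_∸ (suc t' + suc t')) (split t' d) ⟩
    ((suc t' + suc t') + suc (d + d)) ∸ (suc t' + suc t')
      ≡⟨ m+n∸m≡n (suc t' + suc t') (suc (d + d)) ⟩
    suc (d + d) ∎
    where
    open ≡-Reasoning
    d = k ∸ t'
    split : ∀ t' d → suc (suc (suc ((t' + d) + (t' + d)))) ≡ (suc t' + suc t') + suc (d + d)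
    split = solve-∀

  odd-count : ∀ u → u < m → sumBelow w (λ t' → χ (u ≟ m ∸ (suc t' + suc t'))) + bit (even? u) ≡ 1
  odd-count u u<m with double-or-odd u
  ... | inj₁ (h , refl) =
    cong₂ _+_ (sumBelow-χ-none w (λ t' → h + h ≟ m ∸ (suc t' + suc t'))
                (λ t' t'<w e → double≢odd h (k ∸ t') (trans e (m-minus-double t' t'<w))))
              (cong bit (even?-double h))
  ... | inj₂ (h , refl) = cong₂ _+_ once (cong bit (even?-odd h))
    where
    h≤k : h ≤ k
    h≤k = double-at-most-k (≤-pred (≤-pred u<m))
    t₀<w : k ∸ h < w
    t₀<w = s≤s (m∸n≤m k h)
    once : sumBelow w (λ t' → χ (suc (h + h) ≟ m ∸ (suc t' + suc t'))) ≡ 1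
    once = sumBelow-χ-unique w (λ t' → suc (h + h) ≟ m ∸ (suc t' + suc t')) (k ∸ h) t₀<w
      (sym (trans (m-minus-double (k ∸ h) t₀<w) (cong (λ v → suc (v + v)) (m∸[m∸n]≡n h≤k))))
      (λ t' t'<w e → trans (sym (m∸[m∸n]≡n (≤-pred t'<w)))
        (cong (k ∸_) (sym (double-injective {h} {k ∸ t'} (suc-injective (trans e (m-minus-double t' t'<w)))))))

  hits : ℕ → ℕ
  hits v = sumBelow w (λ t' → χ (v ≟ suc t'))

  hits-in : ∀ v → 1 ≤ v → v ≤ w → hits v ≡ 1
  hits-in (suc v) _ (s≤s v≤k) = sumBelow-χ-unique w (λ t' → suc v ≟ suc t') v (s≤s v≤k) refl (λ t' _ e → sym (suc-injective e))

  hits-out : ∀ v → (v ≡ 0 ⊎ w < v) → hits v ≡ 0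
  hits-out v outside = sumBelow-χ-none w (λ t' → v ≟ suc t') (not-hit outside)
    where
    not-hit : (v ≡ 0 ⊎ w < v) → ∀ t' → t' < w → v ≢ suc t'
    not-hit (inj₁ refl) t' _ ()
    not-hit (inj₂ w<v) t' t'<w refl = <-irrefl refl (<-≤-trans w<v t'<w)

  χ-reflect : ∀ u a → u ≤ m → a ≤ m → χ (u ≟ m ∸ a) ≡ χ (m ∸ u ≟ a)
  χ-reflect u a u≤m a≤m with u ≟ m ∸ a | m ∸ u ≟ a
  ... | yes _ | yes _ = refl
  ... | no _ | no _ = refl
  ... | yes e | no ne = ⊥-elim (ne (trans (cong (m ∸_) e) (m∸[m∸n]≡n a≤m)))
  ... | no ne | yes e = ⊥-elim (ne (trans (sym (m∸[m∸n]≡n u≤m)) (cong (m ∸_) e)))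

  m∸w : m ∸ w ≡ suc (suc k)
  m∸w = trans (cong (_∸ k) (e k)) (m+n∸n≡m (suc (suc k)) k)
    where
    e : ∀ k → suc (suc (k + k)) ≡ suc (suc k) + k
    e = solve-∀

  m∸1+w : m ∸ suc w ≡ w
  m∸1+w = trans (cong (_∸ k) (e k)) (m+n∸n≡m (suc k) k)
    where
    e : ∀ k → suc (k + k) ≡ suc k + k
    e = solve-∀

  residue-count : ∀ u → u < m → sumBelow w (λ t' → χ (u ≟ suc t')) + sumBelow w (λ t' → χ (u ≟ m ∸ suc t')) + χ (u ≟ 0) ≡ 1
  residue-count u u<m =
    trans (cong (λ v → hits u + v + χ (u ≟ 0))
                (sumBelow-cong w _ _ (λ t' t'<w → χ-reflect u (suc t') (<⇒≤ u<m) (≤-trans t'<w (<⇒≤ (t<m ≤-refl))))))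
          (split u u<m)
    where
    split : ∀ u → u < m → hits u + hits (m ∸ u) + χ (u ≟ 0) ≡ 1
    split zero _ = cong₂ _+_ (cong₂ _+_ (hits-out 0 (inj₁ refl)) (hits-out m (inj₂ (t<m ≤-refl)))) refl
    split (suc u') u<m with suc u' ≤? w
    ... | yes u≤w = cong₂ _+_ (cong₂ _+_ (hits-in (suc u') (s≤s z≤n) u≤w)
                      (hits-out (m ∸ suc u') (inj₂ (≤-trans (≤-reflexive (sym m∸w)) (∸-monoʳ-≤ m u≤w))))) refl
    ... | no u≰w = cong₂ _+_ (cong₂ _+_ (hits-out (suc u') (inj₂ (≰⇒> u≰w)))
                      (hits-in (m ∸ suc u') (m<n⇒0<n∸m u<m) (≤-trans (∸-monoʳ-≤ m (≰⇒> u≰w)) (≤-reflexive m∸1+w)))) refl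

  -- The residues of the slots of the blocks through ∞:
  --   ρ₁ for cyc l0 t t, ρ₂ for cyc l0 (m - t) t, ρ₃ for cyc l2 0 t.
  ρ₁ ρ₂ ρ₃ : Slot → ℕ → ℕ
  ρ₁ slot₁ t = t + t
  ρ₁ slot₂ t = 0
  ρ₁ slot₃ t = t
  ρ₂ slot₁ t = 0
  ρ₂ slot₂ t = m ∸ (t + t)
  ρ₂ slot₃ t = m ∸ t
  ρ₃ slot₁ t = m ∸ (t + t)
  ρ₃ slot₂ t = t + t
  ρ₃ slot₃ t = 0

  residue-ρ₁ : ∀ s t → t ≤ w → slot-residue s l0 t t ≡ ρ₁ s t
  residue-ρ₁ slot₁ t t≤w = trans (cong (λ v → (t + v) % m) (*-identityˡ t)) (m<n⇒m%n≡m (t+t'<m t≤w t≤w))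
  residue-ρ₁ slot₂ t t≤w = sym (cong proj₁ (∞-at-slot₂ t))
  residue-ρ₁ slot₃ t t≤w = refl

  residue-ρ₂ : ∀ s t → 1 ≤ t → t ≤ w → slot-residue s l0 (m ∸ t) t ≡ ρ₂ s t
  residue-ρ₂ slot₁ t _ t≤w = sym (cong proj₁ (∞-at-slot₁ t (t≤m t≤w)))
  residue-ρ₂ slot₂ t 1≤t t≤w = ≈-residue (m%n<n (m ∸ t + β l0 * t) m) (m∸t<m (≤-trans 1≤t (m≤m+n t t)))
    (≈-cancelʳ (t + t) (begin
      (m ∸ t + β l0 * t) % m + (t + t)   ≈⟨ ≈-+ (%-≈ (m ∸ t + β l0 * t)) ≈-refl ⟩
      (m ∸ t + β l0 * t) + (t + t)       ≡⟨ regroup (m ∸ t) (β l0 * t) t ⟩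
      (m ∸ t + t) + m * t                ≈⟨ ≈-+ (≈-trans (≈-reflexive (m∸n+n≡m (t≤m t≤w))) m≈0) (m*≈0 t) ⟩
      0                                  ≈⟨ ≈-sym m≈0 ⟩
      m                                  ≡⟨ sym (m∸n+n≡m (<⇒≤ (t+t'<m t≤w t≤w))) ⟩
      m ∸ (t + t) + (t + t)              ∎))
    where
    open ≈-Reasoning
    regroup : ∀ a b t → (a + b) + (t + t) ≡ (a + t) + (t + b)
    regroup = solve-∀
  residue-ρ₂ slot₃ t _ t≤w = refl

  residue-ρ₃ : ∀ s t → 1 ≤ t → t ≤ w → slot-residue s l2 0 t ≡ ρ₃ s t
  residue-ρ₃ slot₁ t 1≤t t≤w = ≈-residue (m%n<n (0 + α l2 * t) m) (m∸t<m (≤-trans 1≤t (m≤m+n t t)))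
    (≈-cancelʳ (t + t) (begin
      (0 + α l2 * t) % m + (t + t)   ≈⟨ ≈-+ (%-≈ (0 + α l2 * t)) ≈-refl ⟩
      0 + α l2 * t + (t + t)         ≡⟨ trans (collect (α l2) t) (cong (_* t) (α+β≡m l2)) ⟩
      m * t                          ≈⟨ m*≈0 t ⟩
      0                              ≈⟨ ≈-sym m≈0 ⟩
      m                              ≡⟨ sym (m∸n+n≡m (<⇒≤ (t+t'<m t≤w t≤w))) ⟩
      m ∸ (t + t) + (t + t)          ∎))
    where
    open ≈-Reasoning
    collect : ∀ a t → 0 + a * t + (t + t) ≡ (a + 2) * t
    collect = solve-∀
  residue-ρ₃ slot₂ t _ t≤w = trans (cong (_% m) (double t)) (m<n⇒m%n≡m (t+t'<m t≤w t≤w))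
    where
    double : ∀ t → 0 + 2 * t ≡ t + t
    double = solve-∀
  residue-ρ₃ slot₃ t _ t≤w = refl

  vert-slot : Level → Slot
  vert-slot l0 = slot₁
  vert-slot l1 = slot₂
  vert-slot l2 = slot₃

  cell-vert : ∀ u j → cell (vert u) (vert-slot j) ≡ (u , j)
  cell-vert u l0 = refl
  cell-vert u l1 = refl
  cell-vert u l2 = refl

  vert-bit : Slot → Level → ℕ → ℕ
  vert-bit s j u = χ (symbol (vert u) (vert-slot j) FP.≟ cyc-symbol s)

  sum-ρ : (Slot → ℕ → ℕ) → Slot → ℕ → ℕ
  sum-ρ ρ s u = sumBelow w (λ t' → χ (u ≟ ρ s (suc t')))

  module ThroughInfinity (u : ℕ) (j : Level) (s : Slot) (u<m : u < m) where
    occurs : Column → ℕ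
    occurs c = χ (entry c (u , j) FP.≟ cyc-symbol s)

    on-level0 on-level2 : ℕ
    on-level0 = χ (j ≟ℓ slot-level s l0)
    on-level2 = χ (j ≟ℓ slot-level s l2)

    occurs-vert-u : occurs (vert u) ≡ vert-bit s j u
    occurs-vert-u = cong (λ v → χ (v FP.≟ cyc-symbol s))
      (trans (cong (entry (vert u)) (sym (cell-vert u j))) (entry-at-cell (vert u) (cells-distinct (vert u) u<m) (vert-slot j)))

    occurs-vert-0 : occurs (vert 0) ≡ χ (u ≟ 0) * occurs (vert u)
    occurs-vert-0 = by-cases (u ≟ 0)
      where
      by-cases : (u≟0 : Dec (u ≡ 0)) → occurs (vert 0) ≡ χ u≟0 * occurs (vert u)
      by-cases (yes refl) = sym (+-identityʳ _)
      by-cases (no u≢0) = χ-entry-off-column (vert 0) (u , j) s (λ s' e → u≢0 (on-vert (s' , e)))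

    occurs-level0 : ∀ t' → t' < w → occurs (cyc l0 (suc t') (suc t')) + occurs (cyc l0 (m ∸ suc t') (suc t'))
                  ≡ on-level0 * (χ (u ≟ ρ₁ s (suc t')) + χ (u ≟ ρ₂ s (suc t')))
    occurs-level0 t' t'<w = trans (cong₂ _+_
      (trans (χ-entry-cyc u j s l0 (suc t') (suc t') (t<m t'<w , s≤s z≤n , t'<w))
             (cong (λ v → on-level0 * χ (u ≟ v)) (residue-ρ₁ s (suc t') t'<w)))
      (trans (χ-entry-cyc u j s l0 (m ∸ suc t') (suc t') (m∸t<m {suc t'} (s≤s z≤n) , s≤s z≤n , t'<w))
             (cong (λ v → on-level0 * χ (u ≟ v)) (residue-ρ₂ s (suc t') (s≤s z≤n) t'<w))))
      (sym (*-distribˡ-+ on-level0 _ _))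

    occurs-level2 : ∀ t' → t' < w → occurs (cyc l2 0 (suc t')) ≡ on-level2 * χ (u ≟ ρ₃ s (suc t'))
    occurs-level2 t' t'<w = trans (χ-entry-cyc u j s l2 0 (suc t') (s≤s z≤n , s≤s z≤n , t'<w))
      (cong (λ v → on-level2 * χ (u ≟ v)) (residue-ρ₃ s (suc t') (s≤s z≤n) t'<w))

    removed : sumOver (through∞ occurs) all-columns ≡
      on-level0 * (sum-ρ ρ₁ s u + sum-ρ ρ₂ s u) + (on-level2 * sum-ρ ρ₃ s u + χ (u ≟ 0) * vert-bit s j u)
    removed = trans (through∞-sum occurs) (cong₂ _+_ level0 (cong₂ _+_ level2 (trans occurs-vert-0 (cong (χ (u ≟ 0) *_) occurs-vert-u))))
      where
      level0 : sumBelow w (λ t' → occurs (cyc l0 (suc t') (suc t')) + occurs (cyc l0 (m ∸ suc t') (suc t')))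
               ≡ on-level0 * (sum-ρ ρ₁ s u + sum-ρ ρ₂ s u)
      level0 = trans (sumBelow-cong w _ _ occurs-level0)
        (trans (sumBelow-*ˡ w on-level0 (λ t' → χ (u ≟ ρ₁ s (suc t')) + χ (u ≟ ρ₂ s (suc t'))))
               (cong (on-level0 *_) (sumBelow-+ w (λ t' → χ (u ≟ ρ₁ s (suc t'))) (λ t' → χ (u ≟ ρ₂ s (suc t'))))))
      level2 : sumBelow w (λ t' → occurs (cyc l2 0 (suc t'))) ≡ on-level2 * sum-ρ ρ₃ s u
      level2 = trans (sumBelow-cong w _ _ occurs-level2) (sumBelow-*ˡ w on-level2 (λ t' → χ (u ≟ ρ₃ s (suc t'))))

  σ₀ᵇ-one : ∀ b → χ (σ₀ᵇ b FP.≟ one) ≡ bit b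
  σ₀ᵇ-one true = refl
  σ₀ᵇ-one false = refl

  σ₀ᵇ-three : ∀ b → χ (σ₀ᵇ b FP.≟ three) ≡ 0
  σ₀ᵇ-three true = refl
  σ₀ᵇ-three false = refl

  σ₂ᵇ-three : ∀ b → χ (σ₂ᵇ b FP.≟ three) ≡ 0
  σ₂ᵇ-three true = refl
  σ₂ᵇ-three false = refl

  u≢0 : ∀ {u} → (u , l0) ≢ ∞ → u ≢ 0
  u≢0 p≢∞ u≡0 = p≢∞ (cong (_, l0) u≡0)

  odd≢0 : ∀ {u} → even? u ≡ false → u ≢ 0
  odd≢0 () refl

  no-zero-hits : ∀ {u} → u ≢ 0 → sumBelow w (λ _ → χ (u ≟ 0)) ≡ 0
  no-zero-hits {u} u≢0 = sumBelow-χ-none w (λ _ → u ≟ 0) (λ _ _ → u≢0)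

  first-only : ∀ P Z c Y X → Z ≡ 0 → c ≡ 0 → 1 * (P + Z) + (0 * Y + c * X) ≡ P
  first-only P .0 .0 Y X refl refl = trans (+-identityʳ _) (trans (+-identityʳ _) (+-identityʳ P))

  second-only : ∀ P Z c Y X → Z ≡ 0 → c ≡ 0 → 1 * (Z + P) + (0 * Y + c * X) ≡ P
  second-only P .0 .0 Y X refl refl = trans (+-identityʳ _) (+-identityʳ P)

  odd-fills-level2-one : ∀ P c b → P + bit b ≡ 1 → (b ≡ false → c ≡ 0) →
                         1 * P + c * χ (σ₂ᵇ b FP.≟ one) ≡ χ (σ₂ᵇ b FP.≟ one)
  odd-fills-level2-one P c true P+1≡1 _ =
    trans (cong₂ _+_ (+-identityʳ P) (*-zeroʳ c)) (trans (+-identityʳ P) (+-cancelʳ-≡ 1 P 0 P+1≡1))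
  odd-fills-level2-one P c false P≡1 odd⇒c≡0 rewrite odd⇒c≡0 refl =
    trans (+-identityʳ _) (trans (+-identityʳ P) (trans (sym (+-identityʳ P)) P≡1))

  odd-fills-level0-two : ∀ P b → P + bit b ≡ 1 → P ≡ χ (σ₀ᵇ b FP.≟ two)
  odd-fills-level0-two P true P+1≡1 = +-cancelʳ-≡ 1 P 0 P+1≡1
  odd-fills-level0-two P false P+0≡1 = trans (sym (+-identityʳ P)) P+0≡1

  even-fills-level2-two : ∀ P c b → P + c ≡ bit b → 1 * P + c * χ (σ₂ᵇ b FP.≟ two) ≡ χ (σ₂ᵇ b FP.≟ two)
  even-fills-level2-two P c true P+c≡1 = trans (cong₂ _+_ (+-identityʳ P) (*-identityʳ c)) P+c≡1
  even-fills-level2-two P c false P+c≡0 = trans (cong₂ _+_ (+-identityʳ P) (*-zeroʳ c)) (trans (+-identityʳ P) (m+n≡0⇒m≡0 P P+c≡0))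

  -- For a point (u, j) ≠ ∞, the blocks through ∞ give its row the symbol of slot s
  -- exactly as often as the vertical block at u does; case by case this is one of the
  -- three counting facts (1)-(3) above.
  removed-count : ∀ s j u → u < m → (u , j) ≢ ∞ →
    χ (j ≟ℓ slot-level s l0) * (sum-ρ ρ₁ s u + sum-ρ ρ₂ s u)
      + (χ (j ≟ℓ slot-level s l2) * sum-ρ ρ₃ s u + χ (u ≟ 0) * vert-bit s j u)
    ≡ vert-bit s j u
  removed-count slot₁ l0 u u<m p≢∞ =
    trans (first-only (sum-ρ ρ₁ slot₁ u) (sum-ρ ρ₂ slot₁ u) (χ (u ≟ 0)) (sum-ρ ρ₃ slot₁ u) (vert-bit slot₁ l0 u)
                      (no-zero-hits (u≢0 p≢∞)) (χ-no (u ≟ 0) (u≢0 p≢∞)))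
      (trans (sym (+-identityʳ _)) (trans (cong (sum-ρ ρ₁ slot₁ u +_) (sym (χ-no (u ≟ 0) (u≢0 p≢∞))))
        (trans (even-count u u<m) (sym (σ₀ᵇ-one (even? u))))))
  removed-count slot₁ l1 u u<m p≢∞ = *-zeroʳ (χ (u ≟ 0))
  removed-count slot₁ l2 u u<m p≢∞ =
    odd-fills-level2-one (sum-ρ ρ₃ slot₁ u) (χ (u ≟ 0)) (even? u) (odd-count u u<m) (λ odd → χ-no (u ≟ 0) (odd≢0 odd))
  removed-count slot₂ l0 u u<m p≢∞ =
    trans (second-only (sum-ρ ρ₂ slot₂ u) (sum-ρ ρ₁ slot₂ u) (χ (u ≟ 0)) (sum-ρ ρ₃ slot₂ u) (vert-bit slot₂ l0 u)
                       (no-zero-hits (u≢0 p≢∞)) (χ-no (u ≟ 0) (u≢0 p≢∞)))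
      (odd-fills-level0-two (sum-ρ ρ₂ slot₂ u) (even? u) (odd-count u u<m))
  removed-count slot₂ l1 u u<m p≢∞ = *-zeroʳ (χ (u ≟ 0))
  removed-count slot₂ l2 u u<m p≢∞ = even-fills-level2-two (sum-ρ ρ₃ slot₂ u) (χ (u ≟ 0)) (even? u) (even-count u u<m)
  removed-count slot₃ l0 u u<m p≢∞ rewrite σ₀ᵇ-three (even? u) =
    cong₂ _+_ (trans (+-identityʳ _) (no-zero-hits (u≢0 p≢∞))) (*-zeroʳ (χ (u ≟ 0)))
  removed-count slot₃ l1 u u<m p≢∞ =
    trans (cong₂ _+_ (+-identityʳ (sum-ρ ρ₁ slot₃ u + sum-ρ ρ₂ slot₃ u)) (*-identityʳ (χ (u ≟ 0)))) (residue-count u u<m)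
  removed-count slot₃ l2 u u<m p≢∞ rewrite σ₂ᵇ-three (even? u) = *-zeroʳ (χ (u ≟ 0))

  -- Each row other than ∞ has composition (w, w, w) within the kept blocks: the full
  -- design gives w plus the vertical bit, and the blocks through ∞ take the bit away.
  row-composition : ∀ u j s → u < m → (u , j) ≢ ∞ → sumOver (λ c → χ (entry c (u , j) FP.≟ cyc-symbol s)) columns ≡ w
  row-composition u j s u<m p≢∞ = +-cancelʳ-≡ (vert-bit s j u) _ _ (begin
    sumOver occurs columns + vert-bit s j u
      ≡⟨ cong (sumOver occurs columns +_) (sym (trans removed (removed-count s j u u<m p≢∞))) ⟩
    sumOver occurs columns + sumOver (through∞ occurs) all-columns
      ≡⟨ sumOver-filter-∞ occurs all-columns ⟩
    sumOver occurs all-columns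
      ≡⟨ all-columns-symbol-count u j s u<m ⟩
    w + χ (entry (vert u) (u , j) FP.≟ cyc-symbol s)
      ≡⟨ cong (w +_) occurs-vert-u ⟩
    w + vert-bit s j u ∎)
    where
    open ThroughInfinity u j s u<m using (occurs; occurs-vert-u; removed)
    open ≡-Reasoning

  nonzero≤1 : ∀ a → nonzero a ≤ 1
  nonzero≤1 fz = z≤n
  nonzero≤1 (fs _) = s≤s z≤n

  nonzero-product≤1 : ∀ a b → nonzero a * nonzero b ≤ 1
  nonzero-product≤1 fz b = z≤n
  nonzero-product≤1 (fs _) b = ≤-trans (≤-reflexive (+-identityʳ (nonzero b))) (nonzero≤1 b)

  nonzero-product-positive : ∀ a b → 1 ≤ nonzero a * nonzero b → 1 ≤ nonzero a × 1 ≤ nonzero b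
  nonzero-product-positive (fs _) b h = s≤s z≤n , ≤-trans h (≤-reflexive (+-identityʳ (nonzero b)))

  -- By the packing property, the supports of two distinct rows meet in at most one column.
  support-overlap≤1 : ∀ p q → p ≢ q → sumOver (λ c → nonzero (entry c p) * nonzero (entry c q)) columns ≤ 1
  support-overlap≤1 p q p≢q =
    ≤-trans (sumOver-columns-≤ both) (AtMostOne.total both (λ c → nonzero-product≤1 (entry c p) (entry c q)) unique)
    where
    both : Column → ℕ
    both c = nonzero (entry c p) * nonzero (entry c q)
    unique : ∀ c c' → InRange c → InRange c' → 1 ≤ both c → 1 ≤ both c' → c ≡ c'
    unique c c' r r' h h' with nonzero-product-positive (entry c p) (entry c q) h | nonzero-product-positive (entry c' p) (entry c' q) h'
    ... | hp , hq | hp' , hq' = packing p q c c' p≢q r r'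
      (nonzero-on-column c p hp) (nonzero-on-column c q hq) (nonzero-on-column c' p hp') (nonzero-on-column c' q hq')

  -- The length: of the m·(3w + 1) blocks, the 3w + 1 through ∞ are removed.
  n : ℕ
  n = 6 * w * w + 2 * w

  length-columns : length columns ≡ n
  length-columns = begin
    length columns                                          ≡⟨ sym (sumOver-1 columns) ⟩
    sumOver (λ _ → 1) columns                               ≡⟨ +-cancelʳ-≡ _ _ _ (begin
      sumOver (λ _ → 1) columns + (w * 2 + (w * 1 + 1))       ≡⟨ cong (sumOver (λ _ → 1) columns +_) (sym removed) ⟩
      sumOver (λ _ → 1) columns + sumOver (through∞ (λ _ → 1)) all-columns
                                                              ≡⟨ sumOver-filter-∞ (λ _ → 1) all-columns ⟩
      sumOver (λ _ → 1) all-columns                           ≡⟨ total ⟩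
      w * (m * 1) + (w * (m * 1) + (w * (m * 1) + m * 1))     ≡⟨ sym (block-count k) ⟩
      n + (w * 2 + (w * 1 + 1))                               ∎) ⟩
    n                                                       ∎
    where
    open ≡-Reasoning
    level : ∀ i → level-sum i (λ _ → 1) ≡ w * (m * 1)
    level i = trans (sumBelow-cong w _ _ (λ t' _ → sumBelow-const m 1)) (sumBelow-const w (m * 1))
    total : sumOver (λ _ → 1) all-columns ≡ w * (m * 1) + (w * (m * 1) + (w * (m * 1) + m * 1))
    total = trans (sumOver-all-columns (λ _ → 1)) (cong₂ _+_ (level l0) (cong₂ _+_ (level l1) (cong₂ _+_ (level l2) (sumBelow-const m 1))))
    removed : sumOver (through∞ (λ _ → 1)) all-columns ≡ w * 2 + (w * 1 + 1)
    removed = trans (through∞-sum (λ _ → 1)) (cong₂ _+_ (sumBelow-const w 2) (cong (_+ 1) (sumBelow-const w 1)))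
    block-count : ∀ k → (6 * suc k * suc k + 2 * suc k) + (suc k * 2 + (suc k * 1 + 1)) ≡
      suc k * (suc (suc (suc (k + k))) * 1) + (suc k * (suc (suc (suc (k + k))) * 1)
        + (suc k * (suc (suc (suc (k + k))) * 1) + suc (suc (suc (k + k))) * 1))
    block-count = solve-∀

  row : Point → (xs : List Column) → Vec (Fin 4) (length xs)
  row p [] = []
  row p (c ∷ cs) = entry c p ∷ row p cs

  codeword : Point → Word n
  codeword p = subst Word length-columns (row p columns)

  count-row : ∀ a p xs → count a (row p xs) ≡ sumOver (λ c → χ (entry c p FP.≟ a)) xs
  count-row a p [] = refl
  count-row a p (c ∷ cs) = trans (count-step a (entry c p) (row p cs)) (cong (χ (entry c p FP.≟ a) +_) (count-row a p cs))

  dist-row : ∀ p q xs → dist (row p xs) (row q xs) ≡ sumOver (λ c → 1 ∸ χ (entry c p FP.≟ entry c q)) xs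
  dist-row p q [] = refl
  dist-row p q (c ∷ cs) = trans (dist-step (entry c p) (entry c q) (row p cs) (row q cs))
    (cong ((1 ∸ χ (entry c p FP.≟ entry c q)) +_) (dist-row p q cs))

  weight-row : ∀ p xs → weight (row p xs) ≡ sumOver (λ c → nonzero (entry c p)) xs
  weight-row p [] = refl
  weight-row p (c ∷ cs) = cong (nonzero (entry c p) +_) (weight-row p cs)

  count-codeword : ∀ a p → count a (codeword p) ≡ sumOver (λ c → χ (entry c p FP.≟ a)) columns
  count-codeword a p = trans (count-subst a length-columns (row p columns)) (count-row a p columns)

  dist-codeword : ∀ p q → dist (codeword p) (codeword q) ≡ sumOver (λ c → 1 ∸ χ (entry c p FP.≟ entry c q)) columns
  dist-codeword p q = trans (dist-subst length-columns (row p columns) (row q columns)) (dist-row p q columns)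

  weight-codeword : ∀ p → weight (codeword p) ≡ sumOver (λ c → nonzero (entry c p)) columns
  weight-codeword p = trans (weight-subst length-columns (row p columns)) (weight-row p columns)

  Row : Point → Set
  Row (u , j) = u < m × (u , j) ≢ ∞

  codeword-composition : ∀ p → Row p → HasComposition w w w (codeword p)
  codeword-composition (u , j) (u<m , p≢∞) =
    trans (count-codeword one (u , j)) (row-composition u j slot₁ u<m p≢∞) ,
    trans (count-codeword two (u , j)) (row-composition u j slot₂ u<m p≢∞) ,
    trans (count-codeword three (u , j)) (row-composition u j slot₃ u<m p≢∞)

  coordinate-lower-bound : ∀ a b → (a ≡ b → a ≢ fz → ⊥) → nonzero a + nonzero b ≤ (1 ∸ χ (a FP.≟ b)) + nonzero a * nonzero b
  coordinate-lower-bound fz fz _ = decide-≤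
  coordinate-lower-bound fz (fs fz) _ = decide-≤
  coordinate-lower-bound fz (fs (fs fz)) _ = decide-≤
  coordinate-lower-bound fz (fs (fs (fs fz))) _ = decide-≤
  coordinate-lower-bound (fs fz) fz _ = decide-≤
  coordinate-lower-bound (fs fz) (fs fz) no-repeat = ⊥-elim (no-repeat refl (λ ()))
  coordinate-lower-bound (fs fz) (fs (fs fz)) _ = decide-≤
  coordinate-lower-bound (fs fz) (fs (fs (fs fz))) _ = decide-≤
  coordinate-lower-bound (fs (fs fz)) fz _ = decide-≤
  coordinate-lower-bound (fs (fs fz)) (fs fz) _ = decide-≤
  coordinate-lower-bound (fs (fs fz)) (fs (fs fz)) no-repeat = ⊥-elim (no-repeat refl (λ ()))
  coordinate-lower-bound (fs (fs fz)) (fs (fs (fs fz))) _ = decide-≤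
  coordinate-lower-bound (fs (fs (fs fz))) fz _ = decide-≤
  coordinate-lower-bound (fs (fs (fs fz))) (fs fz) _ = decide-≤
  coordinate-lower-bound (fs (fs (fs fz))) (fs (fs fz)) _ = decide-≤
  coordinate-lower-bound (fs (fs (fs fz))) (fs (fs (fs fz))) no-repeat = ⊥-elim (no-repeat refl (λ ()))

  d : ℕ
  d = 2 * (3 * w) ∸ 1

  -- Two codewords of weight 3w whose supports meet at most once, with different
  -- symbols there, are at distance at least 6w - 1.
  codeword-distance : ∀ p q → Row p → Row q → p ≢ q → d ≤ dist (codeword p) (codeword q)
  codeword-distance p q rp rq p≢q = subst (d ≤_) (sym (dist-codeword p q)) (m≤n+o⇒m∸n≤o (2 * (3 * w)) 1 (begin
    2 * (3 * w)                                               ≡⟨ six-w w ⟩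
    (w + w + w) + (w + w + w)                                 ≡⟨ sym (cong₂ _+_ (row-weight p rp) (row-weight q rq)) ⟩
    sumOver (support p) columns + sumOver (support q) columns ≡⟨ sym (sumOver-+ (support p) (support q) columns) ⟩
    sumOver (λ c → support p c + support q c) columns         ≤⟨ sumOver-mono _ _ columns columns-in-range coordinate ⟩
    sumOver (λ c → mismatch c + common c) columns             ≡⟨ sumOver-+ mismatch common columns ⟩
    D + sumOver common columns                                ≤⟨ +-monoʳ-≤ D (support-overlap≤1 p q p≢q) ⟩
    D + 1                                                     ≡⟨ +-comm D 1 ⟩
    1 + D                                                     ∎))
    where
    open ≤-Reasoning
    support : Point → Column → ℕ
    support p c = nonzero (entry c p)
    mismatch common : Column → ℕ
    mismatch c = 1 ∸ χ (entry c p FP.≟ entry c q)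
    common c = support p c * support q c
    D : ℕ
    D = sumOver mismatch columns
    row-weight : ∀ p → Row p → sumOver (support p) columns ≡ w + w + w
    row-weight p rp = trans (sym (weight-codeword p)) (weight-composition (codeword p) (codeword-composition p rp))
    coordinate : ∀ c → InRange c → support p c + support q c ≤ mismatch c + common c
    coordinate c r = coordinate-lower-bound (entry c p) (entry c q) (no-repeated-symbol c (cells-distinct c r) p q p≢q)
    six-w : ∀ w → 2 * (3 * w) ≡ (w + w + w) + (w + w + w)
    six-w = solve-∀

  1≤d : 1 ≤ d
  1≤d = subst (λ v → 1 ≤ v ∸ 1) (sym (e k)) (s≤s z≤n)
    where
    e : ∀ k → 2 * (3 * suc k) ≡ suc (suc (6 * k + 4))
    e = solve-∀

  point₀ point₁ point₂ : ℕ → Point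
  point₀ u = (suc u , l0)
  point₁ u = (u , l1)
  point₂ u = (u , l2)

  row-points : List Point
  row-points = applyUpTo point₀ (m ∸ 1) ++ (applyUpTo point₁ m ++ applyUpTo point₂ m)

  row-points-valid : All Row row-points
  row-points-valid = All.++⁺ (All.applyUpTo⁺₁ point₀ (m ∸ 1) (λ u<m-1 → s≤s u<m-1 , λ ()))
    (All.++⁺ (All.applyUpTo⁺₁ point₁ m (λ u<m → u<m , λ ())) (All.applyUpTo⁺₁ point₂ m (λ u<m → u<m , λ ())))

  row-points-distinct : AllPairs _≢_ row-points
  row-points-distinct =
    AllPairs.++⁺ (AllPairs.applyUpTo⁺₁ point₀ (m ∸ 1) (λ i<j _ e → <-irrefl (suc-injective (cong proj₁ e)) i<j))
      (AllPairs.++⁺ (AllPairs.applyUpTo⁺₁ point₁ m (λ i<j _ e → <-irrefl (cong proj₁ e) i<j))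
                    (AllPairs.applyUpTo⁺₁ point₂ m (λ i<j _ e → <-irrefl (cong proj₁ e) i<j))
                    (All.applyUpTo⁺₂ point₁ m (λ _ → All.applyUpTo⁺₂ point₂ m (λ _ ()))))
      (All.applyUpTo⁺₂ point₀ (m ∸ 1)
        (λ _ → All.++⁺ (All.applyUpTo⁺₂ point₁ m (λ _ ())) (All.applyUpTo⁺₂ point₂ m (λ _ ()))))

  code : List (Word n)
  code = map codeword row-points

  code-is-CC : IsCCCode n d w w w code
  code-is-CC = AllPairs.map⁺ (AP.map (far-words-distinct 1≤d) far) ,
               All.map⁺ (All.map (λ {p} → codeword-composition p) row-points-valid) ,
               AllPairs.map⁺ far
    where
    far : AllPairs (λ p q → d ≤ dist (codeword p) (codeword q)) row-points
    far = allPairs-with (λ {p} {q} → codeword-distance p q) row-points-valid row-points-distinct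

  length-code : length code ≡ 6 * w + 2
  length-code = begin
    length (map codeword row-points)   ≡⟨ length-map codeword row-points ⟩
    length row-points                  ≡⟨ length-++ (applyUpTo point₀ (m ∸ 1)) ⟩
    length (applyUpTo point₀ (m ∸ 1)) + length (applyUpTo point₁ m ++ applyUpTo point₂ m)
                                       ≡⟨ cong₂ _+_ (length-applyUpTo point₀ (m ∸ 1)) (trans (length-++ (applyUpTo point₁ m))
                                            (cong₂ _+_ (length-applyUpTo point₁ m) (length-applyUpTo point₂ m))) ⟩
    (m ∸ 1) + (m + m)                  ≡⟨ point-count k ⟩
    6 * w + 2                          ∎
    where
    open ≡-Reasoning
    point-count : ∀ k → suc (suc (k + k)) + (suc (suc (suc (k + k))) + suc (suc (suc (k + k)))) ≡ 6 * suc k + 2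
    point-count = solve-∀

proposition17 : (w₁ : ℕ) → 1 ≤ w₁ →
    A₄≡ (6 * w₁ * w₁ + 2 * w₁) (2 * (3 * w₁) ∸ 1) w₁ w₁ w₁ (6 * w₁ + 2)
proposition17 zero ()
proposition17 (suc k) _ = (code , code-is-CC , length-code) , code-size-at-most-6w+2 (suc k)
  where open Construction k
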